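{- Let $P=\{p_1,\dots,p_n\}\subset\mathbb{C}$ be a configuration whose points lie on the boundary of a convex polygon, listed in counterclockwise order along that boundary, and suppose $p_n$ and $p_1$ are vertices of the polygon. Then: (1) the subposet of $\textsc{NC}(P)$ consisting of all partitions in which $p_{n-1}$ and $p_n$ lie in the same block is isomorphic to $\textsc{NC}(P\setminus\{p_n\})$; (2) the subposet of $\textsc{NC}(P)$ consisting of all partitions in which either $p_{n-1}$ and $p_n$ lie in the same block or $\{p_n\}$ is a singleton block is isomorphic to the direct product $\textsc{NC}(P\setminus\{p_n\})\times\textsc{NC}(\{p_{n-1},p_n\})$.
   Context: For a finite set $Q\subset\mathbb{C}$, a partition of $Q$ is noncrossing if the convex hulls of its blocks are pairwise disjoint; $\textsc{NC}(Q)$ is the set of noncrossing partitions of $Q$ ordered by refinement ($\pi\le\mu$ iff every block of $\mu$ is a union of blocks of $\pi$). Subposets carry the induced order; direct products of posets carry the componentwise order. Note $\textsc{NC}(\{p_{n-1},p_n\})$ is a two-element chain. -}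

module Defs where

open import Level using (0ℓ)
open import Data.Bool using (Bool; true; false)
open import Data.Nat as ℕ using (ℕ; zero; suc)
open import Data.Fin using (Fin; zero; suc; toℕ)
open import Data.Product using (Σ; _×_; _,_; proj₁; proj₂)
open import Data.Sum using (_⊎_)
open import Function using (_∘_)
open import Relation.Nullary using (¬_)
open import Relation.Binary using (Rel; IsStrictTotalOrder)
open import Relation.Binary.PropositionalEquality using (_≡_)
open import Algebra.Core using (Op₁; Op₂)
open import Algebra.Structures using (IsCommutativeRing)
open import Relation.Binary.Morphism.Structures using (IsOrderIsomorphism)

record RealField : Set₁ where
  infixl 6 _+_
  infixl 7 _*_
  infix  4 _<_ _≤_
  field
    ℝ   : Set
    _+_ : Op₂ ℝ
    _*_ : Op₂ ℝ
    -_  : Op₁ ℝ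
    0#  : ℝ
    1#  : ℝ
    _<_ : Rel ℝ 0ℓ
    isCommutativeRing  : IsCommutativeRing _≡_ _+_ _*_ -_ 0# 1#
    0≢1                : ¬ (0# ≡ 1#)
    inverse            : ∀ x → ¬ (x ≡ 0#) → Σ ℝ λ y → x * y ≡ 1#
    isStrictTotalOrder : IsStrictTotalOrder _≡_ _<_
    +-mono-<           : ∀ {x y} z → x < y → x + z < y + z
    *-pos              : ∀ {x y} → 0# < x → 0# < y → 0# < x * y

  _≤_ : Rel ℝ 0ℓ
  x ≤ y = x < y ⊎ x ≡ y

  field
    complete : (S : ℝ → Set) → Σ ℝ S → (Σ ℝ λ b → ∀ x → S x → x ≤ b) →
               Σ ℝ λ s → (∀ x → S x → x ≤ s) × (∀ b → (∀ x → S x → x ≤ b) → s ≤ b)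

-- Cyclic successor on Fin (suc k)

cyc : ∀ {k} → Fin (suc k) → Fin (suc k)
cyc {zero}  zero    = zero
cyc {suc k} zero    = suc zero
cyc {suc k} (suc i) with cyc i
... | zero  = zero
... | suc j = suc (suc j)

record OrdSet : Set₁ where
  field
    Carrier : Set
    _≈_     : Rel Carrier 0ℓ
    _≲_     : Rel Carrier 0ℓ
open OrdSet public

Sub : (O : OrdSet) → (Carrier O → Set) → OrdSet
Sub O S = record
  { Carrier = Σ (Carrier O) S
  ; _≈_ = λ x y → _≈_ O (proj₁ x) (proj₁ y)
  ; _≲_ = λ x y → _≲_ O (proj₁ x) (proj₁ y)
  }

_×ₒ_ : OrdSet → OrdSet → OrdSet
O ×ₒ O' = record
  { Carrier = Carrier O × Carrier O'
  ; _≈_ = λ x y → _≈_ O (proj₁ x) (proj₁ y) × _≈_ O' (proj₂ x) (proj₂ y)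
  ; _≲_ = λ x y → _≲_ O (proj₁ x) (proj₁ y) × _≲_ O' (proj₂ x) (proj₂ y)
  }

_≅ₒ_ : OrdSet → OrdSet → Set
O ≅ₒ O' = Σ (Carrier O → Carrier O')
            (IsOrderIsomorphism (_≈_ O) (_≈_ O') (_≲_ O) (_≲_ O'))

-- Set partitions of Fin k, as decidable equivalence relations
-- ("same block" relation).  Two partitions are equal iff they have the
-- same blocks, i.e. the same relation.

record Partition (k : ℕ) : Set where
  field
    same     : Fin k → Fin k → Bool
    same-refl  : ∀ i → same i i ≡ true
    same-sym   : ∀ i j → same i j ≡ true → same j i ≡ true
    same-trans : ∀ i j l → same i j ≡ true → same j l ≡ true → same i l ≡ true
open Partition public

module Geometry (R : RealField) where
  open RealField R

  ℂ : Set
  ℂ = ℝ × ℝ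

  re im : ℂ → ℝ
  re = proj₁
  im = proj₂

  sumF : ∀ {k} → (Fin k → ℝ) → ℝ
  sumF {zero}  f = 0#
  sumF {suc k} f = f zero + sumF (f ∘ suc)

  InHull : ∀ {k} → (Fin k → ℂ) → (Fin k → Bool) → ℂ → Set
  InHull q A z =
    Σ (Fin _ → ℝ) λ w →
      (∀ l → 0# ≤ w l) × (∀ l → A l ≡ false → w l ≡ 0#) ×
      (sumF w ≡ 1#) ×
      (sumF (λ l → w l * re (q l)) ≡ re z) ×
      (sumF (λ l → w l * im (q l)) ≡ im z)

  -- blocks of π (indexed by the points they contain)
  block : ∀ {k} → Partition k → Fin k → Fin k → Bool
  block π i = same π i

  NonCrossing : ∀ {k} → (Fin k → ℂ) → Partition k → Set
  NonCrossing q π = ∀ i j → same π i j ≡ false →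
    ¬ (Σ ℂ λ z → InHull q (block π i) z × InHull q (block π j) z)

  -- NC(Q) for the configuration Q = {q 0, …, q (k-1)}, refinement order:
  -- π ≤ μ iff every block of μ is a union of blocks of π,
  -- i.e. points in a common block of π are in a common block of μ.
  NC : ∀ {k} → (Fin k → ℂ) → OrdSet
  NC {k} q = record
    { Carrier = Σ (Partition k) (NonCrossing q)
    ; _≈_ = λ π μ → ∀ i j → same (proj₁ π) i j ≡ same (proj₁ μ) i j
    ; _≲_ = λ π μ → ∀ i j → same (proj₁ π) i j ≡ true → same (proj₁ μ) i j ≡ true
    }

  -- orientation determinant of (a, b, c); positive iff c is strictly left of a→b
  orient : ℂ → ℂ → ℂ → ℝ
  orient a b c = (re b + - re a) * (im c + - im a) + - ((im b + - im a) * (re c + - re a))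

  -- a strictly convex polygon with m+3 vertices, listed counterclockwise
  record ConvexPolygon : Set where
    field
      m      : ℕ
      vert   : Fin (suc (suc (suc m))) → ℂ
      convex : ∀ i l → ¬ (l ≡ i) → ¬ (l ≡ cyc i) →
               0# < orient (vert i) (vert (cyc i)) (vert l)

  -- z = (1 - t) v_e + t v_{e+1} with 0 ≤ t < 1 : the boundary point at
  -- position (e , t) along the boundary
  OnEdge : (K : ConvexPolygon) → Fin (suc (suc (suc (ConvexPolygon.m K)))) → ℝ → ℂ → Set
  OnEdge K e t z =
    (0# ≤ t) × (t < 1#) ×
    (re z ≡ (1# + - t) * re (vert e) + t * re (vert (cyc e))) ×
    (im z ≡ (1# + - t) * im (vert e) + t * im (vert (cyc e)))
    where open ConvexPolygon K

  CCWBoundaryConfig : ∀ {n} → (Fin n → ℂ) → Set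
  CCWBoundaryConfig {n} p =
    Σ ConvexPolygon λ K →
    let open ConvexPolygon K in
    Σ (Fin n → Fin (suc (suc (suc m)))) λ e →
    Σ (Fin n → ℝ) λ t →
      (∀ j → OnEdge K (e j) (t j) (p j)) ×
      -- positions strictly increase counterclockwise
      (∀ i j → toℕ i ℕ.< toℕ j →
         (toℕ (e i) ℕ.< toℕ (e j)) ⊎ ((e i ≡ e j) × (t i < t j))) ×
      (∀ (first : Fin n) → toℕ first ≡ 0 → Σ _ λ v → vert v ≡ p first) ×
      (∀ (lst : Fin n) → suc (toℕ lst) ≡ n → Σ _ λ v → vert v ≡ p lst)

  pair : ℂ → ℂ → Fin 2 → ℂ
  pair x y zero       = x
  pair x y (suc zero) = y

{-# OPTIONS --safe #-}
module Submission where

-- Restricting to P ∖ {pₙ}, and re-inserting pₙ either into the block of pₙ₋₁ or as a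
-- singleton, are mutually inverse and monotone; the point is that re-insertion preserves
-- noncrossing. A singleton {pₙ} is harmless because the vertex pₙ is not in the hull of the
-- other points. For B ∪ {pₙ} with pₙ₋₁ ∈ B and another block C, let a be the first point of
-- B: if C has points on both sides of a, the hulls of B and C already meet; if C lies between
-- a and pₙ₋₁, the line through p a and p pₙ₋₁ separates C from p pₙ, which confines a common
-- point to a triangle inside the hull of B; if C lies before a, the line through p a and
-- p pₙ separates C from B ∪ {pₙ}. Every sign needed comes from convexity: three boundary
-- points in counterclockwise order have nonnegative orientation.

open import Defs
open import Data.Bool using (Bool; true; false)
open import Data.Nat using (ℕ; suc)
open import Data.Fin using (Fin; zero; suc; fromℕ; inject₁)
open import Data.Product using (_×_; proj₁; _,_)
open import Data.Sum using (_⊎_; inj₁; inj₂)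
open import Function using (_∘_; id)
open import Relation.Binary.PropositionalEquality

module FinLemmas where

  open import Data.Nat as ℕ using (ℕ; zero; suc; s≤s; z≤n)
  import Data.Nat.Properties as ℕ
  open import Data.Fin as Fin using (Fin; zero; suc; toℕ; inject₁; fromℕ)
  import Data.Fin.Properties as Fin
  open import Data.Bool using (Bool; true; false)
  open import Data.Maybe as Maybe using (Maybe; just; nothing)
  open import Data.Product using (Σ; _×_; _,_)
  open import Data.Sum using (_⊎_; inj₁; inj₂)
  open import Data.Empty using (⊥; ⊥-elim)
  open import Relation.Binary.PropositionalEquality
  open import Function using (_∘_)

  ∈⇒≢ : ∀ {k} {A : Fin k → Bool} {i j} → A i ≡ true → A j ≡ false → i ≢ j
  ∈⇒≢ i∈A j∉A refl with () ← trans (sym i∈A) j∉A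

  least-index : ∀ {k} (B : Fin k → Bool) i → B i ≡ true →
                Σ (Fin k) λ a → B a ≡ true × (∀ j → B j ≡ true → toℕ a ℕ.≤ toℕ j)
  least-index {suc k} B i i∈B with B zero in B0
  ... | true  = zero , B0 , λ _ _ → z≤n
  ... | false with i
  ...   | zero   with () ← trans (sym B0) i∈B
  ...   | suc i′ with least-index (B ∘ suc) i′ i∈B
  ...     | a , a∈B , a≤B = suc a , a∈B , λ { zero j∈B → ⊥-elim (∈⇒≢ {A = B} j∈B B0 refl) ; (suc j) j∈B → s≤s (a≤B j j∈B) }

  toℕ<k : ∀ {k} (i : Fin (suc k)) → i ≢ fromℕ k → toℕ i ℕ.< k
  toℕ<k {k} i i≢last = ℕ.≤∧≢⇒< (ℕ.≤-pred (Fin.toℕ<n i)) (λ i≡k → i≢last (Fin.toℕ-injective (trans i≡k (sym (Fin.toℕ-fromℕ k)))))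

  _∷ʳ_ : ∀ {k} {X : Set} → (Fin k → X) → X → Fin (suc k) → X
  _∷ʳ_ {zero}  f x zero    = x
  _∷ʳ_ {suc k} f x zero    = f zero
  _∷ʳ_ {suc k} f x (suc i) = ((f ∘ suc) ∷ʳ x) i

  ∷ʳ-inject₁ : ∀ {k} {X : Set} (f : Fin k → X) x l → (f ∷ʳ x) (inject₁ l) ≡ f l
  ∷ʳ-inject₁ {suc k} f x zero    = refl
  ∷ʳ-inject₁ {suc k} f x (suc l) = ∷ʳ-inject₁ (f ∘ suc) x l

  ∷ʳ-last : ∀ {k} {X : Set} (f : Fin k → X) x → (f ∷ʳ x) (fromℕ k) ≡ x
  ∷ʳ-last {zero}  f x = refl
  ∷ʳ-last {suc k} f x = ∷ʳ-last (f ∘ suc) x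

  inject₁-or-last : ∀ {k} (i : Fin (suc k)) → (Σ (Fin k) λ l → i ≡ inject₁ l) ⊎ i ≡ fromℕ k
  inject₁-or-last {zero}  zero    = inj₂ refl
  inject₁-or-last {suc k} zero    = inj₁ (zero , refl)
  inject₁-or-last {suc k} (suc i) with inject₁-or-last i
  ... | inj₁ (l , i≡l) = inj₁ (suc l , cong suc i≡l)
  ... | inj₂ i≡last    = inj₂ (cong suc i≡last)

  inject₁⁻¹ : ∀ {k} → Fin (suc k) → Maybe (Fin k)
  inject₁⁻¹ {zero}  zero    = nothing
  inject₁⁻¹ {suc k} zero    = just zero
  inject₁⁻¹ {suc k} (suc i) = Maybe.map suc (inject₁⁻¹ i)

  inject₁⁻¹-inject₁ : ∀ {k} (l : Fin k) → inject₁⁻¹ (inject₁ l) ≡ just l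
  inject₁⁻¹-inject₁ {suc k} zero    = refl
  inject₁⁻¹-inject₁ {suc k} (suc l) rewrite inject₁⁻¹-inject₁ l = refl

  inject₁⁻¹-fromℕ : ∀ k → inject₁⁻¹ (fromℕ k) ≡ nothing
  inject₁⁻¹-fromℕ zero    = refl
  inject₁⁻¹-fromℕ (suc k) rewrite inject₁⁻¹-fromℕ k = refl

  inject₁⁻¹≡nothing : ∀ {k} (i : Fin (suc k)) → inject₁⁻¹ i ≡ nothing → i ≡ fromℕ k
  inject₁⁻¹≡nothing {zero}  zero    _ = refl
  inject₁⁻¹≡nothing {suc k} (suc i) eq with inject₁⁻¹ i in eqᵢ
  ... | nothing = cong suc (inject₁⁻¹≡nothing i eqᵢ)

  inject₁⁻¹≡just : ∀ {k} (i : Fin (suc k)) a → inject₁⁻¹ i ≡ just a → i ≡ inject₁ a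
  inject₁⁻¹≡just {suc k} zero    .zero refl = refl
  inject₁⁻¹≡just {suc k} (suc i) a eq with inject₁⁻¹ i in eqᵢ
  inject₁⁻¹≡just {suc k} (suc i) .(suc b) refl | just b = cong suc (inject₁⁻¹≡just i b eqᵢ)

  -- Saturates at K, so that polygon vertices can be indexed by ℕ.
  clamp : ∀ {K} → ℕ → Fin (suc K)
  clamp             zero    = zero
  clamp {zero}  (suc i) = zero
  clamp {suc K} (suc i) = suc (clamp i)

  toℕ-clamp : ∀ {K} i → i ℕ.≤ K → toℕ (clamp {K} i) ≡ i
  toℕ-clamp         zero    _         = refl
  toℕ-clamp {suc K} (suc i) (s≤s i≤K) = cong suc (toℕ-clamp i i≤K)

  clamp-toℕ : ∀ {K} (x : Fin (suc K)) → clamp (toℕ x) ≡ x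
  clamp-toℕ x = Fin.toℕ-injective (toℕ-clamp (toℕ x) (ℕ.≤-pred (Fin.toℕ<n x)))

  toℕ-cyc : ∀ {k} (x : Fin (suc k)) → toℕ (cyc x) ≡ suc (toℕ x) ⊎ toℕ (cyc x) ≡ 0
  toℕ-cyc {zero}  zero    = inj₂ refl
  toℕ-cyc {suc k} zero    = inj₁ refl
  toℕ-cyc {suc k} (suc i) with cyc i | toℕ-cyc i
  ... | zero  | _         = inj₂ refl
  ... | suc j | inj₁ j≡i+1 = inj₁ (cong suc j≡i+1)

  toℕ-cyc-< : ∀ {k} (x : Fin (suc k)) → suc (toℕ x) ℕ.< suc k → toℕ (cyc x) ≡ suc (toℕ x)
  toℕ-cyc-< {zero}  zero    (s≤s ())
  toℕ-cyc-< {suc k} zero    _         = refl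
  toℕ-cyc-< {suc k} (suc i) (s≤s i+1<k+1) with cyc i | toℕ-cyc-< i i+1<k+1
  ... | suc j | j≡i+1 = cong suc j≡i+1

  module _ {M : ℕ} where
    private
      toℕ-cyc-small : ∀ (x : Fin (suc (suc (suc M)))) → toℕ x ℕ.≤ 1 → toℕ (cyc x) ≡ suc (toℕ x)
      toℕ-cyc-small x x≤1 = toℕ-cyc-< x (s≤s (s≤s (ℕ.≤-trans x≤1 (s≤s z≤n))))

    cyc-≢ : ∀ (x : Fin (suc (suc (suc M)))) → x ≢ cyc x
    cyc-≢ x x≡cyc = wraps (toℕ-cyc x)
      where
      x≡ : toℕ x ≡ toℕ (cyc x)
      x≡ = cong toℕ x≡cyc
      wraps : toℕ (cyc x) ≡ suc (toℕ x) ⊎ toℕ (cyc x) ≡ 0 → ⊥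
      wraps (inj₁ cyc≡x+1) = ℕ.1+n≢n (sym (trans x≡ cyc≡x+1))
      wraps (inj₂ cyc≡0)   = ℕ.1+n≢0 (trans (sym (toℕ-cyc-small x (subst (ℕ._≤ 1) (sym (trans x≡ cyc≡0)) z≤n))) cyc≡0)

    cyc²-≢ : ∀ (x : Fin (suc (suc (suc M)))) → x ≢ cyc (cyc x)
    cyc²-≢ x x≡cyc² = wraps (toℕ-cyc x) (toℕ-cyc (cyc x))
      where
      x≡ : toℕ x ≡ toℕ (cyc (cyc x))
      x≡ = cong toℕ x≡cyc²
      wraps : toℕ (cyc x) ≡ suc (toℕ x) ⊎ toℕ (cyc x) ≡ 0 → toℕ (cyc (cyc x)) ≡ suc (toℕ (cyc x)) ⊎ toℕ (cyc (cyc x)) ≡ 0 → ⊥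
      wraps (inj₁ c₁) (inj₁ c₂) = ℕ.<-irrefl (trans x≡ (trans c₂ (cong suc c₁))) (ℕ.<-trans (ℕ.n<1+n _) (ℕ.n<1+n _))
      wraps (inj₁ c₁) (inj₂ c₂) =
        ℕ.1+n≢0 (trans (sym (toℕ-cyc-small (cyc x) (subst (ℕ._≤ 1) (sym (trans c₁ (cong suc (trans x≡ c₂)))) ℕ.≤-refl))) c₂)
      wraps (inj₂ c₁) (inj₁ c₂) =
        ℕ.1+n≢0 (trans (sym (toℕ-cyc-small x (subst (ℕ._≤ 1) (sym (trans x≡ (trans c₂ (cong suc c₁)))) ℕ.≤-refl))) c₁)
      wraps (inj₂ c₁) (inj₂ c₂) = ℕ.1+n≢0 (trans (sym (toℕ-cyc-small (cyc x) (subst (ℕ._≤ 1) (sym c₁) z≤n))) c₂)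

module OrderedField (R : RealField) where

  open import Level using (0ℓ)
  open import Data.Nat as ℕ using (ℕ; zero; suc)
  open import Data.Integer as ℤ using (ℤ; -[1+_])
  import Data.Integer.Properties as ℤ
  import Data.Nat.Properties as ℕ
  open import Data.Sign as Sign using (Sign)
  open import Data.Maybe using (Maybe; just; nothing)
  open import Data.Product using (proj₁; proj₂)
  open import Relation.Binary.PropositionalEquality
  open import Relation.Nullary using (¬_; yes; no)
  open import Data.Empty using (⊥-elim)
  open import Data.Sum using (_⊎_; inj₁; inj₂)
  open import Relation.Binary.Definitions using (tri<; tri≈; tri>)
  open import Relation.Binary.Structures using (IsStrictTotalOrder)
  open import Algebra.Bundles using (CommutativeRing)
  open import Algebra.Solver.Ring.AlmostCommutativeRing
    using (AlmostCommutativeRing; fromCommutativeRing; _-Raw-AlmostCommutative⟶_)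

  open RealField R public

  infixl 6 _-_
  _-_ : ℝ → ℝ → ℝ
  x - y = x + - y

  commutativeRing : CommutativeRing 0ℓ 0ℓ
  commutativeRing = record { isCommutativeRing = isCommutativeRing }

  open CommutativeRing commutativeRing public
    using ( +-assoc; +-comm; +-identityˡ; +-identityʳ; -‿inverseʳ
          ; *-assoc; *-comm; *-identityˡ; *-identityʳ; zeroˡ; zeroʳ; distribˡ; distribʳ )
  open import Algebra.Properties.Ring (CommutativeRing.ring commutativeRing) public
    using (-‿distribˡ-*; -‿distribʳ-*; -‿involutive; -0#≈0#; -‿anti-homo-+; -1*x≈-x)
  open import Algebra.Properties.CommutativeSemigroup (CommutativeRing.+-commutativeSemigroup commutativeRing)
    using () renaming (interchange to +-interchange)
  open import Algebra.Properties.CommutativeSemigroup (CommutativeRing.*-commutativeSemigroup commutativeRing)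
    using () renaming (interchange to *-interchange)
  open import Algebra.Properties.Semiring.Mult.TCOptimised (CommutativeRing.semiring commutativeRing)
    using (×-homo-+; ×1-homo-*) renaming (_×_ to _×ᴿ_)

  -- The ring solver computes with numerals in a coefficient ring; with ℤ, mapped to ℝ by
  -- n ↦ n ×ᴿ 1#, closed terms such as 1 - 1 normalise, so identities involving 1# are found.
  private
    ⟦_⟧ℕ : ℕ → ℝ
    ⟦ n ⟧ℕ = n ×ᴿ 1#

    ⟦_⟧ : ℤ → ℝ
    ⟦ ℤ.+ n ⟧    = ⟦ n ⟧ℕ
    ⟦ -[1+ n ] ⟧ = - ⟦ suc n ⟧ℕ

    ⟦_⟧ₛ : Sign → ℝ
    ⟦ Sign.+ ⟧ₛ = 1#
    ⟦ Sign.- ⟧ₛ = - 1#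

    ⟦suc⟧ : ∀ n → ⟦ suc n ⟧ℕ ≡ 1# + ⟦ n ⟧ℕ
    ⟦suc⟧ = ×-homo-+ 1# 1

    x+y-[x+z] : ∀ x y z → (x + y) - (x + z) ≡ y - z
    x+y-[x+z] x y z = begin
      (x + y) - (x + z)      ≡⟨ cong ((x + y) +_) (trans (-‿anti-homo-+ x z) (+-comm _ _)) ⟩
      (x + y) + (- x + - z)  ≡⟨ +-interchange x y (- x) (- z) ⟩
      (x - x) + (y - z)      ≡⟨ cong (_+ (y - z)) (-‿inverseʳ x) ⟩
      0# + (y - z)           ≡⟨ +-identityˡ _ ⟩
      y - z                  ∎
      where open ≡-Reasoning

    ⊖-homo : ∀ m n → ⟦ m ℤ.⊖ n ⟧ ≡ ⟦ m ⟧ℕ - ⟦ n ⟧ℕ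
    ⊖-homo m       zero    = trans (cong ⟦_⟧ (ℤ.⊖-≥ {m} {0} ℕ.z≤n)) (sym (trans (cong (⟦ m ⟧ℕ +_) -0#≈0#) (+-identityʳ _)))
    ⊖-homo zero    (suc n) = trans (cong ⟦_⟧ (ℤ.⊖-< {0} {suc n} ℕ.z<s)) (sym (+-identityˡ _))
    ⊖-homo (suc m) (suc n) = begin
      ⟦ suc m ℤ.⊖ suc n ⟧                  ≡⟨ cong ⟦_⟧ (ℤ.[1+m]⊖[1+n]≡m⊖n m n) ⟩
      ⟦ m ℤ.⊖ n ⟧                          ≡⟨ ⊖-homo m n ⟩
      ⟦ m ⟧ℕ - ⟦ n ⟧ℕ                      ≡⟨ sym (x+y-[x+z] 1# _ _) ⟩
      (1# + ⟦ m ⟧ℕ) - (1# + ⟦ n ⟧ℕ)        ≡⟨ sym (cong₂ _-_ (⟦suc⟧ m) (⟦suc⟧ n)) ⟩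
      ⟦ suc m ⟧ℕ - ⟦ suc n ⟧ℕ              ∎
      where open ≡-Reasoning

    +-homo : ∀ i j → ⟦ i ℤ.+ j ⟧ ≡ ⟦ i ⟧ + ⟦ j ⟧
    +-homo -[1+ m ] -[1+ n ] = begin
      - ⟦ suc (suc m ℕ.+ n) ⟧ℕ              ≡⟨ cong -_ (cong (_×ᴿ 1#) (sym (ℕ.+-suc (suc m) n))) ⟩
      - ⟦ suc m ℕ.+ suc n ⟧ℕ                ≡⟨ cong -_ (×-homo-+ 1# (suc m) (suc n)) ⟩
      - (⟦ suc m ⟧ℕ + ⟦ suc n ⟧ℕ)           ≡⟨ trans (-‿anti-homo-+ _ _) (+-comm _ _) ⟩
      - ⟦ suc m ⟧ℕ + - ⟦ suc n ⟧ℕ           ∎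
      where open ≡-Reasoning
    +-homo -[1+ m ] (ℤ.+ n)    = trans (⊖-homo n (suc m)) (+-comm _ _)
    +-homo (ℤ.+ m)    -[1+ n ] = ⊖-homo m (suc n)
    +-homo (ℤ.+ m)    (ℤ.+ n)    = ×-homo-+ 1# m n

    -‿homo : ∀ i → ⟦ ℤ.- i ⟧ ≡ - ⟦ i ⟧
    -‿homo -[1+ n ]    = sym (-‿involutive _)
    -‿homo (ℤ.+ zero)    = sym -0#≈0#
    -‿homo (ℤ.+ (suc n)) = refl

    ◃-homo : ∀ s n → ⟦ s ℤ.◃ n ⟧ ≡ ⟦ s ⟧ₛ * ⟦ n ⟧ℕ
    ◃-homo s        zero    = sym (zeroʳ _)
    ◃-homo Sign.+ (suc n) = sym (*-identityˡ _)
    ◃-homo Sign.- (suc n) = sym (-1*x≈-x _)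

    sign-*-homo : ∀ s t → ⟦ s Sign.* t ⟧ₛ ≡ ⟦ s ⟧ₛ * ⟦ t ⟧ₛ
    sign-*-homo Sign.+ t      = sym (*-identityˡ _)
    sign-*-homo Sign.- Sign.+ = sym (*-identityʳ _)
    sign-*-homo Sign.- Sign.- = sym (trans (-1*x≈-x (- 1#)) (-‿involutive 1#))

    sign◃abs : ∀ i → ⟦ i ⟧ ≡ ⟦ ℤ.sign i ⟧ₛ * ⟦ ℤ.∣ i ∣ ⟧ℕ
    sign◃abs i = trans (cong ⟦_⟧ (sym (ℤ.◃-inverse i))) (◃-homo (ℤ.sign i) ℤ.∣ i ∣)

    *-homo : ∀ i j → ⟦ i ℤ.* j ⟧ ≡ ⟦ i ⟧ * ⟦ j ⟧
    *-homo i j = begin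
      ⟦ i ℤ.* j ⟧                                                  ≡⟨ ◃-homo (ℤ.sign i Sign.* ℤ.sign j) (ℤ.∣ i ∣ ℕ.* ℤ.∣ j ∣) ⟩
      ⟦ ℤ.sign i Sign.* ℤ.sign j ⟧ₛ * ⟦ ℤ.∣ i ∣ ℕ.* ℤ.∣ j ∣ ⟧ℕ     ≡⟨ cong₂ _*_ (sign-*-homo (ℤ.sign i) _) (×1-homo-* ℤ.∣ i ∣ _) ⟩
      (⟦ ℤ.sign i ⟧ₛ * ⟦ ℤ.sign j ⟧ₛ) * (⟦ ℤ.∣ i ∣ ⟧ℕ * ⟦ ℤ.∣ j ∣ ⟧ℕ) ≡⟨ *-interchange _ _ _ _ ⟩
      (⟦ ℤ.sign i ⟧ₛ * ⟦ ℤ.∣ i ∣ ⟧ℕ) * (⟦ ℤ.sign j ⟧ₛ * ⟦ ℤ.∣ j ∣ ⟧ℕ) ≡⟨ sym (cong₂ _*_ (sign◃abs i) (sign◃abs j)) ⟩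
      ⟦ i ⟧ * ⟦ j ⟧                                                ∎
      where open ≡-Reasoning

    almostCommutativeRing : AlmostCommutativeRing 0ℓ 0ℓ
    almostCommutativeRing = fromCommutativeRing commutativeRing

    ℤ⟶ℝ : ℤ.+-*-rawRing -Raw-AlmostCommutative⟶ almostCommutativeRing
    ℤ⟶ℝ = record
      { ⟦_⟧ = ⟦_⟧ ; +-homo = +-homo ; *-homo = *-homo ; -‿homo = -‿homo ; 0-homo = refl ; 1-homo = refl }

    ℤ-weaklyDecidable : ∀ i j → Maybe (⟦ i ⟧ ≡ ⟦ j ⟧)
    ℤ-weaklyDecidable i j with i ℤ.≟ j
    ... | yes refl = just refl
    ... | no _     = nothing

  open import Algebra.Solver.Ring ℤ.+-*-rawRing almostCommutativeRing ℤ⟶ℝ ℤ-weaklyDecidable public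
    using (Polynomial; solve; _:=_; con; _:+_; _:*_; :-_; _:-_)


  open IsStrictTotalOrder isStrictTotalOrder public
    using (compare; _<?_) renaming (trans to <-trans)

  <-irrefl : ∀ {x} → ¬ (x < x)
  <-irrefl = IsStrictTotalOrder.irrefl isStrictTotalOrder refl

  <⇒≢ : ∀ {x y} → x < y → x ≢ y
  <⇒≢ x<x refl = <-irrefl x<x

  <-asym : ∀ {x y} → x < y → ¬ (y < x)
  <-asym x<y y<x = <-irrefl (<-trans x<y y<x)

  ≤-refl : ∀ {x} → x ≤ x
  ≤-refl = inj₂ refl

  <-≤-trans : ∀ {x y z} → x < y → y ≤ z → x < z
  <-≤-trans x<y (inj₁ y<z)  = <-trans x<y y<z
  <-≤-trans x<y (inj₂ refl) = x<y

  ≤-<-trans : ∀ {x y z} → x ≤ y → y < z → x < z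
  ≤-<-trans (inj₁ x<y)  y<z = <-trans x<y y<z
  ≤-<-trans (inj₂ refl) y<z = y<z

  ≤-antisym : ∀ {x y} → x ≤ y → y ≤ x → x ≡ y
  ≤-antisym (inj₂ x≡y) _           = x≡y
  ≤-antisym (inj₁ _)   (inj₂ y≡x)  = sym y≡x
  ≤-antisym (inj₁ x<y) (inj₁ y<x)  = ⊥-elim (<-asym x<y y<x)

  ≤⇒≯ : ∀ {x y} → x ≤ y → ¬ (y < x)
  ≤⇒≯ x≤y y<x = <-irrefl (≤-<-trans x≤y y<x)

  ≤∨> : ∀ x y → x ≤ y ⊎ y < x
  ≤∨> x y with compare x y
  ... | tri< x<y _ _ = inj₁ (inj₁ x<y)
  ... | tri≈ _ x≡y _ = inj₁ (inj₂ x≡y)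
  ... | tri> _ _ y<x = inj₂ y<x

  +-monoʳ-< : ∀ z {x y} → x < y → z + x < z + y
  +-monoʳ-< z {x} {y} x<y = subst₂ _<_ (+-comm x z) (+-comm y z) (+-mono-< z x<y)

  +-mono-≤ : ∀ {a b c d} → a ≤ b → c ≤ d → a + c ≤ b + d
  +-mono-≤ {c = c} (inj₁ a<b)  (inj₁ c<d)  = inj₁ (<-trans (+-mono-< c a<b) (+-monoʳ-< _ c<d))
  +-mono-≤ {c = c} (inj₁ a<b)  (inj₂ refl) = inj₁ (+-mono-< c a<b)
  +-mono-≤         (inj₂ refl) (inj₁ c<d)  = inj₁ (+-monoʳ-< _ c<d)
  +-mono-≤         (inj₂ refl) (inj₂ refl) = ≤-refl

  +-mono-<-≤ : ∀ {a b c d} → a < b → c ≤ d → a + c < b + d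
  +-mono-<-≤ {c = c} a<b c≤d = <-≤-trans (+-mono-< c a<b) (+-mono-≤ ≤-refl c≤d)

  x<y⇒0<y-x : ∀ {x y} → x < y → 0# < y - x
  x<y⇒0<y-x {x} x<y = subst (_< _) (-‿inverseʳ x) (+-mono-< (- x) x<y)

  private
    y-x+x≡y : ∀ y x → y - x + x ≡ y
    y-x+x≡y = solve 2 (λ y x → y :- x :+ x := y) refl

  0<y-x⇒x<y : ∀ {x y} → 0# < y - x → x < y
  0<y-x⇒x<y {x} {y} 0<y-x = subst₂ _<_ (+-identityˡ x) (y-x+x≡y y x) (+-mono-< x 0<y-x)

  x≤y⇒0≤y-x : ∀ {x y} → x ≤ y → 0# ≤ y - x
  x≤y⇒0≤y-x (inj₁ x<y)        = inj₁ (x<y⇒0<y-x x<y)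
  x≤y⇒0≤y-x {x} (inj₂ refl) = inj₂ (sym (-‿inverseʳ x))

  0≤y-x⇒x≤y : ∀ {x y} → 0# ≤ y - x → x ≤ y
  0≤y-x⇒x≤y (inj₁ 0<y-x) = inj₁ (0<y-x⇒x<y 0<y-x)
  0≤y-x⇒x≤y {x} {y} (inj₂ 0≡y-x) = inj₂ (trans (sym (+-identityˡ x)) (trans (cong (_+ x) 0≡y-x) (y-x+x≡y y x)))

  x<0⇒0<-x : ∀ {x} → x < 0# → 0# < - x
  x<0⇒0<-x {x} x<0 = subst (0# <_) (+-identityˡ (- x)) (x<y⇒0<y-x x<0)

  0<x⇒-x<0 : ∀ {x} → 0# < x → - x < 0#
  0<x⇒-x<0 {x} 0<x = 0<y-x⇒x<y (subst (0# <_) (solve 1 (λ x → x := con (ℤ.+ 0) :- :- x) refl x) 0<x)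

  0<-x⇒x<0 : ∀ {x} → 0# < - x → x < 0#
  0<-x⇒x<0 {x} 0<-x = subst (_< 0#) (-‿involutive x) (0<x⇒-x<0 0<-x)

  0≤x⇒-x≤0 : ∀ {x} → 0# ≤ x → - x ≤ 0#
  0≤x⇒-x≤0 (inj₁ 0<x)  = inj₁ (0<x⇒-x<0 0<x)
  0≤x⇒-x≤0 (inj₂ refl) = inj₂ -0#≈0#

  x≤0⇒0≤-x : ∀ {x} → x ≤ 0# → 0# ≤ - x
  x≤0⇒0≤-x (inj₁ x<0)  = inj₁ (x<0⇒0<-x x<0)
  x≤0⇒0≤-x (inj₂ refl) = inj₂ (sym -0#≈0#)

  0≤-x⇒x≤0 : ∀ {x} → 0# ≤ - x → x ≤ 0#
  0≤-x⇒x≤0 {x} 0≤-x = subst (_≤ 0#) (-‿involutive x) (0≤x⇒-x≤0 0≤-x)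

  0<1 : 0# < 1#
  0<1 with compare 0# 1#
  ... | tri< 0<1 _ _ = 0<1
  ... | tri≈ _ 0≡1 _ = ⊥-elim (0≢1 0≡1)
  ... | tri> _ _ 1<0 = ⊥-elim (<-asym 1<0 (subst (0# <_) [-1]*[-1]≡1 (*-pos (x<0⇒0<-x 1<0) (x<0⇒0<-x 1<0))))
    where
    [-1]*[-1]≡1 : - 1# * - 1# ≡ 1#
    [-1]*[-1]≡1 = solve 0 (:- con (ℤ.+ 1) :* :- con (ℤ.+ 1) := con (ℤ.+ 1)) refl

  0≤1 : 0# ≤ 1#
  0≤1 = inj₁ 0<1

  *-nonNeg : ∀ {x y} → 0# ≤ x → 0# ≤ y → 0# ≤ x * y
  *-nonNeg     (inj₁ 0<x)  (inj₁ 0<y)  = inj₁ (*-pos 0<x 0<y)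
  *-nonNeg {x} _           (inj₂ refl) = inj₂ (sym (zeroʳ x))
  *-nonNeg {y = y} (inj₂ refl) _       = inj₂ (sym (zeroˡ y))

  *-pos-neg : ∀ {x y} → 0# < x → y < 0# → x * y < 0#
  *-pos-neg {x} {y} 0<x y<0 = 0<-x⇒x<0 (subst (0# <_) (sym (-‿distribʳ-* x y)) (*-pos 0<x (x<0⇒0<-x y<0)))

  *-nonNeg-nonPos : ∀ {x y} → 0# ≤ x → y ≤ 0# → x * y ≤ 0#
  *-nonNeg-nonPos {x} {y} 0≤x y≤0 = 0≤-x⇒x≤0 (subst (0# ≤_) (sym (-‿distribʳ-* x y)) (*-nonNeg 0≤x (x≤0⇒0≤-x y≤0)))

  +-pos-nonNeg : ∀ {x y} → 0# < x → 0# ≤ y → 0# < x + y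
  +-pos-nonNeg 0<x 0≤y = subst (_< _) (+-identityʳ 0#) (+-mono-<-≤ 0<x 0≤y)

  +-nonNeg-pos : ∀ {x y} → 0# ≤ x → 0# < y → 0# < x + y
  +-nonNeg-pos {x} {y} 0≤x 0<y = subst (0# <_) (+-comm y x) (+-pos-nonNeg 0<y 0≤x)

  +-nonNeg : ∀ {x y} → 0# ≤ x → 0# ≤ y → 0# ≤ x + y
  +-nonNeg 0≤x 0≤y = subst (_≤ _) (+-identityʳ 0#) (+-mono-≤ 0≤x 0≤y)

  0<c*x⇒0<x : ∀ {c x} → 0# < c → 0# < c * x → 0# < x
  0<c*x⇒0<x {c} {x} 0<c 0<cx with compare 0# x
  ... | tri< 0<x _ _ = 0<x
  ... | tri≈ _ refl _ = ⊥-elim (<-irrefl (subst (0# <_) (zeroʳ c) 0<cx))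
  ... | tri> _ _ x<0 = ⊥-elim (<-asym 0<cx (*-pos-neg 0<c x<0))

  c*x≡0⇒x≡0 : ∀ {c x} → 0# < c → c * x ≡ 0# → x ≡ 0#
  c*x≡0⇒x≡0 {c} {x} 0<c cx≡0 with compare 0# x
  ... | tri< 0<x _ _ = ⊥-elim (<⇒≢ (*-pos 0<c 0<x) (sym cx≡0))
  ... | tri≈ _ 0≡x _ = sym 0≡x
  ... | tri> _ _ x<0 = ⊥-elim (<⇒≢ (*-pos-neg 0<c x<0) cx≡0)

  _⁻¹⟨_⟩ : ∀ c → 0# < c → ℝ
  c ⁻¹⟨ 0<c ⟩ = proj₁ (inverse c (λ c≡0 → <⇒≢ 0<c (sym c≡0)))

  *-inverseʳ : ∀ c (0<c : 0# < c) → c * c ⁻¹⟨ 0<c ⟩ ≡ 1#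
  *-inverseʳ c 0<c = proj₂ (inverse c (λ c≡0 → <⇒≢ 0<c (sym c≡0)))

  ⁻¹-pos : ∀ c (0<c : 0# < c) → 0# < c ⁻¹⟨ 0<c ⟩
  ⁻¹-pos c 0<c = 0<c*x⇒0<x 0<c (subst (0# <_) (sym (*-inverseʳ c 0<c)) 0<1)

  convex-comb-pos : ∀ {a b x y} → 0# ≤ a → 0# ≤ b → a + b ≡ 1# → 0# < x → 0# < y → 0# < a * x + b * y
  convex-comb-pos (inj₁ 0<a) 0≤b _ 0<x 0<y = +-pos-nonNeg (*-pos 0<a 0<x) (*-nonNeg 0≤b (inj₁ 0<y))
  convex-comb-pos {b = b} {x} {y} (inj₂ refl) _ 0+b≡1 _ 0<y = subst (0# <_) (sym 0x+by≡y) 0<y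
    where
    0x+by≡y : 0# * x + b * y ≡ y
    0x+by≡y = trans (cong₂ _+_ (zeroˡ x) (cong (_* y) (trans (sym (+-identityˡ b)) 0+b≡1))) (trans (+-identityˡ _) (*-identityˡ y))

module FiniteSums (R : RealField) where

  open OrderedField R
  open Geometry R
  open import Data.Nat using (zero; suc)
  open import Data.Fin as Fin using (Fin; zero; suc; inject₁; fromℕ)
  import Data.Fin.Properties as Fin
  open import Data.Sum using (inj₁; inj₂)
  open import Data.Empty using (⊥-elim)
  open import Relation.Nullary using (yes; no)
  open import Relation.Binary.PropositionalEquality
  open import Function using (_∘_)
  open import Data.Integer as ℤ using ()

  sumF-cong : ∀ {k} {f g : Fin k → ℝ} → (∀ l → f l ≡ g l) → sumF f ≡ sumF g
  sumF-cong {zero}  f≡g = refl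
  sumF-cong {suc k} f≡g = cong₂ _+_ (f≡g zero) (sumF-cong (f≡g ∘ suc))

  sumF-zero : ∀ {k} {f : Fin k → ℝ} → (∀ l → f l ≡ 0#) → sumF f ≡ 0#
  sumF-zero {zero}  f≡0 = refl
  sumF-zero {suc k} f≡0 = trans (cong₂ _+_ (f≡0 zero) (sumF-zero (f≡0 ∘ suc))) (+-identityʳ 0#)

  sumF-+ : ∀ {k} (f g : Fin k → ℝ) → sumF (λ l → f l + g l) ≡ sumF f + sumF g
  sumF-+ {zero}  f g = sym (+-identityʳ 0#)
  sumF-+ {suc k} f g = trans (cong (f zero + g zero +_) (sumF-+ (f ∘ suc) (g ∘ suc)))
    (solve 4 (λ a b c d → a :+ b :+ (c :+ d) := a :+ c :+ (b :+ d)) refl (f zero) (g zero) _ _)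

  sumF-* : ∀ {k} (c : ℝ) (f : Fin k → ℝ) → sumF (λ l → c * f l) ≡ c * sumF f
  sumF-* {zero}  c f = sym (zeroʳ c)
  sumF-* {suc k} c f = trans (cong (c * f zero +_) (sumF-* c (f ∘ suc))) (sym (distribˡ c _ _))

  sumF-nonNeg : ∀ {k} {f : Fin k → ℝ} → (∀ l → 0# ≤ f l) → 0# ≤ sumF f
  sumF-nonNeg {zero}  0≤f = ≤-refl
  sumF-nonNeg {suc k} 0≤f = +-nonNeg (0≤f zero) (sumF-nonNeg (0≤f ∘ suc))

  sumF-nonNeg-≡0 : ∀ {k} {f : Fin k → ℝ} → (∀ l → 0# ≤ f l) → sumF f ≡ 0# → ∀ l → f l ≡ 0#
  sumF-nonNeg-≡0 {suc k} {f} 0≤f Σf≡0 = λ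
    { zero    → nonNeg-+-≡0 (0≤f zero) (sumF-nonNeg (0≤f ∘ suc)) Σf≡0
    ; (suc l) → sumF-nonNeg-≡0 (0≤f ∘ suc)
                  (nonNeg-+-≡0 (sumF-nonNeg (0≤f ∘ suc)) (0≤f zero) (trans (+-comm _ _) Σf≡0)) l }
    where
    nonNeg-+-≡0 : ∀ {a b} → 0# ≤ a → 0# ≤ b → a + b ≡ 0# → a ≡ 0#
    nonNeg-+-≡0 (inj₂ 0≡a) _   _     = sym 0≡a
    nonNeg-+-≡0 (inj₁ 0<a) 0≤b a+b≡0 = ⊥-elim (<⇒≢ (+-pos-nonNeg 0<a 0≤b) (sym a+b≡0))

  sumF-inject₁ : ∀ {k} (f : Fin (suc k) → ℝ) → sumF f ≡ sumF (f ∘ inject₁) + f (fromℕ k)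
  sumF-inject₁ {zero}  f = trans (+-identityʳ _) (sym (+-identityˡ _))
  sumF-inject₁ {suc k} f = trans (cong (f zero +_) (sumF-inject₁ (f ∘ suc))) (sym (+-assoc _ _ _))

  sumF-init : ∀ {k} (f : Fin (suc k) → ℝ) → f (fromℕ k) ≡ 0# → sumF (f ∘ inject₁) ≡ sumF f
  sumF-init f f-last≡0 = sym (trans (sumF-inject₁ f) (trans (cong (sumF (f ∘ inject₁) +_) f-last≡0) (+-identityʳ _)))

  δ : ∀ {k} → Fin k → Fin k → ℝ
  δ a l with l Fin.≟ a
  ... | yes _ = 1#
  ... | no  _ = 0#

  δ-nonNeg : ∀ {k} (a l : Fin k) → 0# ≤ δ a l
  δ-nonNeg a l with l Fin.≟ a
  ... | yes _ = 0≤1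
  ... | no  _ = ≤-refl

  δ-off : ∀ {k} (a l : Fin k) → l ≢ a → δ a l ≡ 0#
  δ-off a l l≢a with l Fin.≟ a
  ... | yes l≡a = ⊥-elim (l≢a l≡a)
  ... | no  _   = refl

  sumF-δ : ∀ {k} (a : Fin k) (f : Fin k → ℝ) → sumF (λ l → δ a l * f l) ≡ f a
  sumF-δ {suc k} zero f =
    trans (cong₂ _+_ (*-identityˡ (f zero)) (sumF-zero (λ l → trans (cong (_* f (suc l)) (δ-off zero (suc l) (λ ()))) (zeroˡ _))))
          (+-identityʳ _)
  sumF-δ {suc k} (suc a) f =
    trans (cong₂ _+_ (trans (cong (_* f zero) (δ-off (suc a) zero (λ ()))) (zeroˡ _))
                     (trans (sumF-cong δ-suc) (sumF-δ a (f ∘ suc))))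
          (+-identityˡ _)
    where
    δ-suc : ∀ l → δ (suc a) (suc l) * f (suc l) ≡ δ a l * f (suc l)
    δ-suc l with suc l Fin.≟ suc a | l Fin.≟ a
    ... | yes _  | yes _ = refl
    ... | no  _  | no  _ = refl
    ... | yes e  | no ne = ⊥-elim (ne (Fin.suc-injective e))
    ... | no ne  | yes e = ⊥-elim (ne (cong suc e))


  δ-at : ∀ {k} (a : Fin k) → δ a a ≡ 1#
  δ-at a with a Fin.≟ a
  ... | yes _   = refl
  ... | no  a≢a = ⊥-elim (a≢a refl)

  _without_ : ∀ {k} → (Fin k → ℝ) → Fin k → Fin k → ℝ
  (w without t) l = w l - δ t l * w t

  without-at : ∀ {k} (w : Fin k → ℝ) t → (w without t) t ≡ 0#
  without-at w t = trans (cong (λ d → w t - d * w t) (δ-at t)) (trans (cong (λ x → w t - x) (*-identityˡ _)) (-‿inverseʳ _))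

  without-off : ∀ {k} (w : Fin k → ℝ) t l → l ≢ t → (w without t) l ≡ w l
  without-off w t l l≢t = trans (cong (λ d → w l - d * w t) (δ-off t l l≢t))
                                (solve 2 (λ w s → w :- con (ℤ.+ 0) :* s := w) refl (w l) (w t))

  sumF-without : ∀ {k} (w : Fin k → ℝ) t (f : Fin k → ℝ) → sumF (λ l → (w without t) l * f l) ≡ sumF (λ l → w l * f l) - w t * f t
  sumF-without w t f = begin
    sumF (λ l → (w without t) l * f l)
      ≡⟨ sumF-cong (λ l → solve 4 (λ w d s x → (w :- d :* s) :* x := w :* x :+ :- s :* (d :* x)) refl (w l) (δ t l) (w t) (f l)) ⟩
    sumF (λ l → w l * f l + - w t * (δ t l * f l))
      ≡⟨ trans (sumF-+ (λ l → w l * f l) (λ l → - w t * (δ t l * f l))) (cong (sumF (λ l → w l * f l) +_) (sumF-* (- w t) (λ l → δ t l * f l))) ⟩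
    sumF (λ l → w l * f l) + - w t * sumF (λ l → δ t l * f l)
      ≡⟨ cong (λ x → sumF (λ l → w l * f l) + - w t * x) (sumF-δ t f) ⟩
    sumF (λ l → w l * f l) + - w t * f t
      ≡⟨ cong (sumF (λ l → w l * f l) +_) (sym (-‿distribˡ-* (w t) (f t))) ⟩
    sumF (λ l → w l * f l) - w t * f t ∎
    where open ≡-Reasoning

module Orientation (R : RealField) where

  open OrderedField R
  open Geometry R
  open import Data.Integer as ℤ using ()
  open import Data.Product using (_,_)
  open import Relation.Binary.PropositionalEquality

  lerp : ℝ → ℂ → ℂ → ℂ
  lerp t u v = ((1# - t) * re u + t * re v , (1# - t) * im u + t * im v)

  orientₚ : ∀ {n} (ax ay bx by cx cy : Polynomial n) → Polynomial n
  orientₚ ax ay bx by cx cy = (bx :- ax) :* (cy :- ay) :- (by :- ay) :* (cx :- ax)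

  lerpₚ : ∀ {n} (t u v : Polynomial n) → Polynomial n
  lerpₚ t u v = (con (ℤ.+ 1) :- t) :* u :+ t :* v

  orient-rotate : ∀ a b c → orient a b c ≡ orient b c a
  orient-rotate (ax , ay) (bx , by) (cx , cy) = solve 6
    (λ ax ay bx by cx cy → orientₚ ax ay bx by cx cy := orientₚ bx by cx cy ax ay) refl ax ay bx by cx cy

  orient-swap : ∀ a b c → orient a c b ≡ - orient a b c
  orient-swap (ax , ay) (bx , by) (cx , cy) = solve 6
    (λ ax ay bx by cx cy → orientₚ ax ay cx cy bx by := :- orientₚ ax ay bx by cx cy) refl ax ay bx by cx cy

  orient-aab : ∀ a b → orient a a b ≡ 0#
  orient-aab (ax , ay) (bx , by) = solve 4
    (λ ax ay bx by → orientₚ ax ay ax ay bx by := con (ℤ.+ 0)) refl ax ay bx by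

  orient-abb : ∀ a b → orient a b b ≡ 0#
  orient-abb (ax , ay) (bx , by) = solve 4
    (λ ax ay bx by → orientₚ ax ay bx by bx by := con (ℤ.+ 0)) refl ax ay bx by

  orient-aba : ∀ a b → orient a b a ≡ 0#
  orient-aba (ax , ay) (bx , by) = solve 4
    (λ ax ay bx by → orientₚ ax ay bx by ax ay := con (ℤ.+ 0)) refl ax ay bx by

  orient-lerp₁ : ∀ t u v a b → orient (lerp t u v) a b ≡ (1# - t) * orient u a b + t * orient v a b
  orient-lerp₁ t (ux , uy) (vx , vy) (ax , ay) (bx , by) = solve 9
    (λ t ux uy vx vy ax ay bx by →
       orientₚ (lerpₚ t ux vx) (lerpₚ t uy vy) ax ay bx by
         := (con (ℤ.+ 1) :- t) :* orientₚ ux uy ax ay bx by :+ t :* orientₚ vx vy ax ay bx by)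
    refl t ux uy vx vy ax ay bx by

  orient-lerp₂ : ∀ a t u v b → orient a (lerp t u v) b ≡ (1# - t) * orient a u b + t * orient a v b
  orient-lerp₂ (ax , ay) t (ux , uy) (vx , vy) (bx , by) = solve 9
    (λ t ux uy vx vy ax ay bx by →
       orientₚ ax ay (lerpₚ t ux vx) (lerpₚ t uy vy) bx by
         := (con (ℤ.+ 1) :- t) :* orientₚ ax ay ux uy bx by :+ t :* orientₚ ax ay vx vy bx by)
    refl t ux uy vx vy ax ay bx by

  orient-lerp₃ : ∀ a b t u v → orient a b (lerp t u v) ≡ (1# - t) * orient a b u + t * orient a b v
  orient-lerp₃ (ax , ay) (bx , by) t (ux , uy) (vx , vy) = solve 9
    (λ t ux uy vx vy ax ay bx by →
       orientₚ ax ay bx by (lerpₚ t ux vx) (lerpₚ t uy vy)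
         := (con (ℤ.+ 1) :- t) :* orientₚ ax ay bx by ux uy :+ t :* orientₚ ax ay bx by vx vy)
    refl t ux uy vx vy ax ay bx by

  orient-lerp-lerp : ∀ s t u v x → orient (lerp s u v) (lerp t u v) x ≡ (t - s) * orient u v x
  orient-lerp-lerp s t (ux , uy) (vx , vy) (xx , xy) = solve 8
    (λ s t ux uy vx vy xx xy →
       orientₚ (lerpₚ s ux vx) (lerpₚ s uy vy) (lerpₚ t ux vx) (lerpₚ t uy vy) xx xy
         := (t :- s) :* orientₚ ux uy vx vy xx xy)
    refl s t ux uy vx vy xx xy

  orient-collinear : ∀ s t r u v → orient (lerp s u v) (lerp t u v) (lerp r u v) ≡ 0#
  orient-collinear s t r (ux , uy) (vx , vy) = solve 7
    (λ s t r ux uy vx vy →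
       orientₚ (lerpₚ s ux vx) (lerpₚ s uy vy) (lerpₚ t ux vx) (lerpₚ t uy vy) (lerpₚ r ux vx) (lerpₚ r uy vy)
         := con (ℤ.+ 0))
    refl s t r ux uy vx vy

  -- Cramer's rule: orient x b c, orient a x c and orient a b x are the barycentric
  -- coordinates of x with respect to abc, scaled by orient a b c; orient p q is affine.
  orient-barycentric : ∀ a b c x p q →
    orient a b c * orient p q x ≡
      orient x b c * orient p q a + orient a x c * orient p q b + orient a b x * orient p q c
  orient-barycentric (ax , ay) (bx , by) (cx , cy) (xx , xy) (px , py) (qx , qy) = solve 12
    (λ ax ay bx by cx cy xx xy px py qx qy →
       orientₚ ax ay bx by cx cy :* orientₚ px py qx qy xx xy
         := orientₚ xx xy bx by cx cy :* orientₚ px py qx qy ax ay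
            :+ orientₚ ax ay xx xy cx cy :* orientₚ px py qx qy bx by
            :+ orientₚ ax ay bx by xx xy :* orientₚ px py qx qy cx cy)
    refl ax ay bx by cx cy xx xy px py qx qy

  private
    lerp-0ᵣ : ∀ u v → (1# - 0#) * u + 0# * v ≡ u
    lerp-0ᵣ = solve 2 (λ u v → lerpₚ (con (ℤ.+ 0)) u v := u) refl

    lerp-1ᵣ : ∀ u v → (1# - 1#) * u + 1# * v ≡ v
    lerp-1ᵣ = solve 2 (λ u v → lerpₚ (con (ℤ.+ 1)) u v := v) refl

    lerp-sameᵣ : ∀ t u → (1# - t) * u + t * u ≡ u
    lerp-sameᵣ = solve 2 (λ t u → lerpₚ t u u := u) refl

  lerp-0 : ∀ u v → lerp 0# u v ≡ u
  lerp-0 (ux , uy) (vx , vy) = cong₂ _,_ (lerp-0ᵣ ux vx) (lerp-0ᵣ uy vy)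

  lerp-1 : ∀ u v → lerp 1# u v ≡ v
  lerp-1 (ux , uy) (vx , vy) = cong₂ _,_ (lerp-1ᵣ ux vx) (lerp-1ᵣ uy vy)

  lerp-same : ∀ t u → lerp t u u ≡ u
  lerp-same t (ux , uy) = cong₂ _,_ (lerp-sameᵣ t ux) (lerp-sameᵣ t uy)

  -- Crossing segments ab and cd meet at the point with weights (orient c b d , orient a c d)
  -- on (a , b) and (orient a b d , orient a c b) on (c , d).
  orient-crossing : ∀ a b c d → orient c b d + orient a c d ≡ orient a b d + orient a c b
  orient-crossing (ax , ay) (bx , by) (cx , cy) (dx , dy) = solve 8
    (λ ax ay bx by cx cy dx dy → orientₚ cx cy bx by dx dy :+ orientₚ ax ay cx cy dx dy
                                 := orientₚ ax ay bx by dx dy :+ orientₚ ax ay cx cy bx by)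
    refl ax ay bx by cx cy dx dy

  orient-crossing-re : ∀ a b c d → orient c b d * re a + orient a c d * re b ≡ orient a b d * re c + orient a c b * re d
  orient-crossing-re (ax , ay) (bx , by) (cx , cy) (dx , dy) = solve 8
    (λ ax ay bx by cx cy dx dy → orientₚ cx cy bx by dx dy :* ax :+ orientₚ ax ay cx cy dx dy :* bx
                                 := orientₚ ax ay bx by dx dy :* cx :+ orientₚ ax ay cx cy bx by :* dx)
    refl ax ay bx by cx cy dx dy

  orient-crossing-im : ∀ a b c d → orient c b d * im a + orient a c d * im b ≡ orient a b d * im c + orient a c b * im d
  orient-crossing-im (ax , ay) (bx , by) (cx , cy) (dx , dy) = solve 8
    (λ ax ay bx by cx cy dx dy → orientₚ cx cy bx by dx dy :* ay :+ orientₚ ax ay cx cy dx dy :* by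
                                 := orientₚ ax ay bx by dx dy :* cy :+ orientₚ ax ay cx cy bx by :* dy)
    refl ax ay bx by cx cy dx dy

  -- Barycentric coordinates of lerp s y c with respect to the triangle y a b.
  lerp-in-triangle : ∀ a b c y s → - orient a b (lerp s y c) + s * orient b c y + s * orient c a y ≡ - orient a b y
  lerp-in-triangle (ax , ay) (bx , by) (cx , cy) (yx , yy) s = solve 9
    (λ ax ay bx by cx cy yx yy s →
       :- orientₚ ax ay bx by (lerpₚ s yx cx) (lerpₚ s yy cy) :+ s :* orientₚ bx by cx cy yx yy :+ s :* orientₚ cx cy ax ay yx yy
         := :- orientₚ ax ay bx by yx yy)
    refl ax ay bx by cx cy yx yy s

  lerp-in-triangle-re : ∀ a b c y s → let z = lerp s y c in
    (- orient a b z + s * orient b c y + s * orient c a y) * re z ≡ - orient a b z * re y + s * orient b c y * re a + s * orient c a y * re b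
  lerp-in-triangle-re (ax , ay) (bx , by) (cx , cy) (yx , yy) s = solve 9
    (λ ax ay bx by cx cy yx yy s →
       (:- orientₚ ax ay bx by (lerpₚ s yx cx) (lerpₚ s yy cy) :+ s :* orientₚ bx by cx cy yx yy :+ s :* orientₚ cx cy ax ay yx yy) :* lerpₚ s yx cx
         := :- orientₚ ax ay bx by (lerpₚ s yx cx) (lerpₚ s yy cy) :* yx :+ s :* orientₚ bx by cx cy yx yy :* ax :+ s :* orientₚ cx cy ax ay yx yy :* bx)
    refl ax ay bx by cx cy yx yy s

  lerp-in-triangle-im : ∀ a b c y s → let z = lerp s y c in
    (- orient a b z + s * orient b c y + s * orient c a y) * im z ≡ - orient a b z * im y + s * orient b c y * im a + s * orient c a y * im b
  lerp-in-triangle-im (ax , ay) (bx , by) (cx , cy) (yx , yy) s = solve 9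
    (λ ax ay bx by cx cy yx yy s →
       (:- orientₚ ax ay bx by (lerpₚ s yx cx) (lerpₚ s yy cy) :+ s :* orientₚ bx by cx cy yx yy :+ s :* orientₚ cx cy ax ay yx yy) :* lerpₚ s yy cy
         := :- orientₚ ax ay bx by (lerpₚ s yx cx) (lerpₚ s yy cy) :* yy :+ s :* orientₚ bx by cx cy yx yy :* ay :+ s :* orientₚ cx cy ax ay yx yy :* by)
    refl ax ay bx by cx cy yx yy s

module ConvexHull (R : RealField) where

  open OrderedField R
  open Orientation R
  open FiniteSums R
  open FinLemmas
  open Geometry R
  open import Data.Nat using (ℕ; suc)
  open import Data.Integer as ℤ using ()
  open import Data.Fin as Fin using (Fin; inject₁; fromℕ)
  import Data.Fin.Properties as Fin
  open import Data.Bool as Bool using (Bool; true; false; _∧_; not)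
  import Data.Bool.Properties as Bool
  open import Data.Product using (Σ; _×_; _,_; proj₁)
  open import Data.Sum using (_⊎_; inj₁; inj₂)
  open import Data.Empty using (⊥-elim)
  open import Relation.Nullary using (¬_; Dec; yes; no; does)
  open import Relation.Binary.PropositionalEquality
  open import Relation.Binary.Definitions using (Tri; tri<; tri≈; tri>)
  open import Function using (_∘_)

  Affine : (ℂ → ℝ) → Set
  Affine F = Σ ℝ λ α → Σ ℝ λ β → Σ ℝ λ γ → ∀ x → F x ≡ α * re x + β * im x + γ

  orient-affine : ∀ a b → Affine (orient a b)
  orient-affine (ax , ay) (bx , by) =
    - (by - ay) , bx - ax , (by - ay) * ax - (bx - ax) * ay , λ (xx , xy) → solve 6
      (λ ax ay bx by xx xy → (bx :- ax) :* (xy :- ay) :- (by :- ay) :* (xx :- ax)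
                            := :- (by :- ay) :* xx :+ (bx :- ax) :* xy :+ ((by :- ay) :* ax :- (bx :- ax) :* ay))
      refl ax ay bx by xx xy

  orient-affine₁ : ∀ b c → Affine (λ x → orient x b c)
  orient-affine₁ b c =
    let (α , β , γ , F≡) = orient-affine b c in α , β , γ , λ x → trans (orient-rotate x b c) (F≡ x)

  -affine : ∀ {F} → Affine F → Affine (λ x → - F x)
  -affine (α , β , γ , F≡) = - α , - β , - γ , λ x → trans (cong -_ (F≡ x))
    (solve 5 (λ a b c x y → :- (a :* x :+ b :* y :+ c) := :- a :* x :+ :- b :* y :+ :- c) refl α β γ (re x) (im x))

  LexPos : ℝ → ℝ → Set
  LexPos a b = 0# < a ⊎ (a ≡ 0# × 0# < b)

  module _ {k : ℕ} (q : Fin k → ℂ) where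

    private
      supported-nonNeg : ∀ {A : Fin k → Bool} {w f : Fin k → ℝ} → (∀ l → 0# ≤ w l) → (∀ l → A l ≡ false → w l ≡ 0#) →
                         (∀ l → A l ≡ true → 0# ≤ f l) → ∀ l → 0# ≤ w l * f l
      supported-nonNeg {A} 0≤w supp 0≤f l with A l in Al
      ... | true  = *-nonNeg (0≤w l) (0≤f l Al)
      ... | false = inj₂ (sym (trans (cong (_* _) (supp l Al)) (zeroˡ _)))

    affine-sumF : ∀ {A z F} → Affine F → (h : InHull q A z) → sumF (λ l → proj₁ h l * F (q l)) ≡ F z
    affine-sumF {A} {z} {F} (α , β , γ , F≡) (w , _ , _ , Σw≡1 , Σwx≡x , Σwy≡y) = begin
      sumF (λ l → w l * F (q l))
        ≡⟨ sumF-cong (λ l → trans (cong (w l *_) (F≡ (q l))) (expand (w l) (re (q l)) (im (q l)))) ⟩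
      sumF (λ l → α * (w l * re (q l)) + β * (w l * im (q l)) + γ * w l)
        ≡⟨ trans (sumF-+ (λ l → α * (w l * re (q l)) + β * (w l * im (q l))) (λ l → γ * w l))
                 (cong (_+ sumF (λ l → γ * w l)) (sumF-+ (λ l → α * (w l * re (q l))) (λ l → β * (w l * im (q l))))) ⟩
      sumF (λ l → α * (w l * re (q l))) + sumF (λ l → β * (w l * im (q l))) + sumF (λ l → γ * w l)
        ≡⟨ cong₂ _+_ (cong₂ _+_ (sumF-* α (λ l → w l * re (q l))) (sumF-* β (λ l → w l * im (q l)))) (sumF-* γ w) ⟩
      α * sumF (λ l → w l * re (q l)) + β * sumF (λ l → w l * im (q l)) + γ * sumF w
        ≡⟨ cong₂ _+_ (cong₂ (λ x y → α * x + β * y) Σwx≡x Σwy≡y) (trans (cong (γ *_) Σw≡1) (*-identityʳ γ)) ⟩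
      α * re z + β * im z + γ
        ≡⟨ sym (F≡ z) ⟩
      F z ∎
      where
      open ≡-Reasoning
      expand : ∀ w x y → w * (α * x + β * y + γ) ≡ α * (w * x) + β * (w * y) + γ * w
      expand w x y = solve 6 (λ w x y a b c → w :* (a :* x :+ b :* y :+ c) := a :* (w :* x) :+ b :* (w :* y) :+ c :* w)
        refl w x y α β γ

    hull-nonNeg : ∀ {A z F} → Affine F → InHull q A z → (∀ l → A l ≡ true → 0# ≤ F (q l)) → 0# ≤ F z
    hull-nonNeg aff h@(_ , 0≤w , supp , _) 0≤F =
      subst (0# ≤_) (affine-sumF aff h) (sumF-nonNeg (supported-nonNeg 0≤w supp 0≤F))

    hull-nonPos : ∀ {A z F} → Affine F → InHull q A z → (∀ l → A l ≡ true → F (q l) ≤ 0#) → F z ≤ 0#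
    hull-nonPos aff h F≤0 = 0≤-x⇒x≤0 (hull-nonNeg (-affine aff) h (λ l l∈A → x≤0⇒0≤-x (F≤0 l l∈A)))

    hull-inhabited : ∀ {A z} → InHull q A z → Σ (Fin k) λ l → A l ≡ true
    hull-inhabited {A} (w , _ , supp , Σw≡1 , _) with Fin.any? (λ l → A l Bool.≟ true)
    ... | yes l∈A = l∈A
    ... | no  A≡∅ = ⊥-elim (0≢1 (trans (sym (sumF-zero w≡0)) Σw≡1))
      where
      w≡0 : ∀ l → w l ≡ 0#
      w≡0 l = supp l (Bool.¬-not (λ l∈A → A≡∅ (l , l∈A)))

    -- A ∧ not (0 < F) is the face of A on which F vanishes.
    hull-face : ∀ {A z F} → Affine F → InHull q A z → (∀ l → A l ≡ true → 0# ≤ F (q l)) → F z ≤ 0# →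
                InHull q (λ l → A l ∧ not (does (0# <? F (q l)))) z
    hull-face {A} {z} {F} aff h@(w , 0≤w , supp , rest) 0≤F Fz≤0 = w , 0≤w , supp′ , rest
      where
      w*F≡0 : ∀ l → w l * F (q l) ≡ 0#
      w*F≡0 = sumF-nonNeg-≡0 (supported-nonNeg 0≤w supp 0≤F)
                (trans (affine-sumF aff h) (≤-antisym Fz≤0 (hull-nonNeg aff h 0≤F)))
      supp′ : ∀ l → A l ∧ not (does (0# <? F (q l))) ≡ false → w l ≡ 0#
      supp′ l l∉A′ with A l in Al | 0# <? F (q l)
      ... | false | _       = supp l Al
      ... | true  | yes 0<F = c*x≡0⇒x≡0 0<F (trans (*-comm _ _) (w*F≡0 l))

    hull-pos : ∀ {A z F} → Affine F → InHull q A z → (∀ l → A l ≡ true → 0# < F (q l)) → 0# < F z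
    hull-pos {A} {z} {F} aff h 0<F with ≤∨> (F z) 0#
    ... | inj₂ 0<Fz = 0<Fz
    ... | inj₁ Fz≤0 = ⊥-elim (off-face (hull-inhabited (hull-face aff h (λ l l∈A → inj₁ (0<F l l∈A)) Fz≤0)))
      where
      off-face : ¬ (Σ (Fin k) λ l → A l ∧ not (does (0# <? F (q l))) ≡ true)
      off-face (l , l∈A′) with A l in Al | 0# <? F (q l)
      ... | true | no ¬0<F = ¬0<F (0<F l Al)

    hull-lexPos : ∀ {A z F G} → Affine F → Affine G → InHull q A z →
                  (∀ l → A l ≡ true → LexPos (F (q l)) (G (q l))) → LexPos (F z) (G z)
    hull-lexPos {A} {z} {F} {G} affF affG h lex with ≤∨> (F z) 0#
    ... | inj₂ 0<Fz = inj₁ 0<Fz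
    ... | inj₁ Fz≤0 = inj₂ (≤-antisym Fz≤0 (hull-nonNeg affF h 0≤F) , hull-pos affG (hull-face affF h 0≤F Fz≤0) 0<G)
      where
      0≤F : ∀ l → A l ≡ true → 0# ≤ F (q l)
      0≤F l l∈A with lex l l∈A
      ... | inj₁ 0<F       = inj₁ 0<F
      ... | inj₂ (F≡0 , _) = inj₂ (sym F≡0)
      0<G : ∀ l → A l ∧ not (does (0# <? F (q l))) ≡ true → 0# < G (q l)
      0<G l l∈A′ with A l in Al | 0# <? F (q l)
      ... | true | no ¬0<F with lex l Al
      ...   | inj₁ 0<F       = ⊥-elim (¬0<F 0<F)
      ...   | inj₂ (_ , 0<G) = 0<G

    hull-point : ∀ {A} l → A l ≡ true → InHull q A (q l)
    hull-point {A} l l∈A = δ l , δ-nonNeg l , supp , trans (sumF-cong {k} (λ l′ → sym (*-identityʳ (δ l l′)))) (sumF-δ l (λ _ → 1#)) ,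
                           sumF-δ l (re ∘ q) , sumF-δ l (im ∘ q)
      where
      supp : ∀ l′ → A l′ ≡ false → δ l l′ ≡ 0#
      supp l′ l′∉A = δ-off l l′ λ { refl → Bool.not-¬ l∈A l′∉A }

    hull-normalise : ∀ {A z} (u : Fin k → ℝ) → (∀ l → 0# ≤ u l) → (∀ l → A l ≡ false → u l ≡ 0#) → 0# < sumF u →
                     sumF (λ l → u l * re (q l)) ≡ sumF u * re z → sumF (λ l → u l * im (q l)) ≡ sumF u * im z →
                     InHull q A z
    hull-normalise {A} {z} u 0≤u supp 0<Σu Σux≡ Σuy≡ =
      (λ l → u l * c) , (λ l → *-nonNeg (0≤u l) (inj₁ (⁻¹-pos _ 0<Σu))) , (λ l l∉A → trans (cong (_* c) (supp l l∉A)) (zeroˡ c)) ,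
      trans (sumF-cong (λ l → *-comm (u l) c)) (trans (sumF-* c u) (trans (*-comm c _) (*-inverseʳ _ 0<Σu))) ,
      scaled re Σux≡ , scaled im Σuy≡
      where
      c : ℝ
      c = sumF u ⁻¹⟨ 0<Σu ⟩
      scaled : (pr : ℂ → ℝ) → sumF (λ l → u l * pr (q l)) ≡ sumF u * pr z → sumF (λ l → u l * c * pr (q l)) ≡ pr z
      scaled pr Σu·pr≡ = begin
        sumF (λ l → u l * c * pr (q l))  ≡⟨ sumF-cong (λ l → solve 3 (λ u c x → u :* c :* x := c :* (u :* x)) refl (u l) c (pr (q l))) ⟩
        sumF (λ l → c * (u l * pr (q l))) ≡⟨ sumF-* c (λ l → u l * pr (q l)) ⟩
        c * sumF (λ l → u l * pr (q l))   ≡⟨ cong (c *_) Σu·pr≡ ⟩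
        c * (sumF u * pr z)               ≡⟨ sym (*-assoc c _ _) ⟩
        c * sumF u * pr z                 ≡⟨ cong (_* pr z) (trans (*-comm c _) (*-inverseʳ _ 0<Σu)) ⟩
        1# * pr z                         ≡⟨ *-identityˡ _ ⟩
        pr z                              ∎
        where open ≡-Reasoning

    hull-mean : ∀ {A} (u : Fin k → ℝ) → (∀ l → 0# ≤ u l) → (∀ l → A l ≡ false → u l ≡ 0#) → 0# < sumF u →
                Σ ℂ λ y → InHull q A y × sumF (λ l → u l * re (q l)) ≡ sumF u * re y × sumF (λ l → u l * im (q l)) ≡ sumF u * im y
    hull-mean u 0≤u supp 0<Σu = y , hull-normalise u 0≤u supp 0<Σu (sym (Σu*y _)) (sym (Σu*y _)) , sym (Σu*y _) , sym (Σu*y _)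
      where
      c : ℝ
      c = sumF u ⁻¹⟨ 0<Σu ⟩
      y : ℂ
      y = (sumF (λ l → u l * re (q l)) * c , sumF (λ l → u l * im (q l)) * c)
      Σu*y : ∀ x → sumF u * (x * c) ≡ x
      Σu*y x = trans (cong (sumF u *_) (*-comm x c)) (trans (sym (*-assoc _ c x)) (trans (cong (_* x) (*-inverseʳ _ 0<Σu)) (*-identityˡ x)))

    hull-convex₃ : ∀ {A z z₁ z₂ z₃} (α β γ : ℝ) → InHull q A z₁ → InHull q A z₂ → InHull q A z₃ →
                   0# ≤ α → 0# ≤ β → 0# ≤ γ → 0# < α + β + γ →
                   (α + β + γ) * re z ≡ α * re z₁ + β * re z₂ + γ * re z₃ →
                   (α + β + γ) * im z ≡ α * im z₁ + β * im z₂ + γ * im z₃ → InHull q A z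
    hull-convex₃ {A} {z} {z₁} {z₂} {z₃} α β γ
      (w₁ , 0≤w₁ , supp₁ , Σw₁≡1 , x₁ , y₁) (w₂ , 0≤w₂ , supp₂ , Σw₂≡1 , x₂ , y₂) (w₃ , 0≤w₃ , supp₃ , Σw₃≡1 , x₃ , y₃)
      0≤α 0≤β 0≤γ 0<α+β+γ re-z im-z =
      hull-normalise u (λ l → +-nonNeg (+-nonNeg (*-nonNeg 0≤α (0≤w₁ l)) (*-nonNeg 0≤β (0≤w₂ l))) (*-nonNeg 0≤γ (0≤w₃ l)))
        (λ l l∉A → trans (cong₃ (supp₁ l l∉A) (supp₂ l l∉A) (supp₃ l l∉A))
                         (solve 3 (λ a b c → a :* con (ℤ.+ 0) :+ b :* con (ℤ.+ 0) :+ c :* con (ℤ.+ 0) := con (ℤ.+ 0)) refl α β γ))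
        (subst (0# <_) (sym Σu≡) 0<α+β+γ) (combine re x₁ x₂ x₃ re-z) (combine im y₁ y₂ y₃ im-z)
      where
      u : Fin k → ℝ
      u l = α * w₁ l + β * w₂ l + γ * w₃ l
      cong₃ : ∀ {a a′ b b′ c c′} → a ≡ a′ → b ≡ b′ → c ≡ c′ → α * a + β * b + γ * c ≡ α * a′ + β * b′ + γ * c′
      cong₃ refl refl refl = refl
      sumF-lin₃ : (f g h : Fin k → ℝ) → sumF (λ l → α * f l + β * g l + γ * h l) ≡ α * sumF f + β * sumF g + γ * sumF h
      sumF-lin₃ f g h = trans (sumF-+ (λ l → α * f l + β * g l) (λ l → γ * h l))
        (cong₂ _+_ (trans (sumF-+ (λ l → α * f l) (λ l → β * g l)) (cong₂ _+_ (sumF-* α f) (sumF-* β g))) (sumF-* γ h))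
      Σu≡ : sumF u ≡ α + β + γ
      Σu≡ = trans (sumF-lin₃ w₁ w₂ w₃) (trans (cong₃ Σw₁≡1 Σw₂≡1 Σw₃≡1) (cong₂ _+_ (cong₂ _+_ (*-identityʳ α) (*-identityʳ β)) (*-identityʳ γ)))
      combine : (pr : ℂ → ℝ) → sumF (λ l → w₁ l * pr (q l)) ≡ pr z₁ → sumF (λ l → w₂ l * pr (q l)) ≡ pr z₂ →
                sumF (λ l → w₃ l * pr (q l)) ≡ pr z₃ → (α + β + γ) * pr z ≡ α * pr z₁ + β * pr z₂ + γ * pr z₃ →
                sumF (λ l → u l * pr (q l)) ≡ sumF u * pr z
      combine pr e₁ e₂ e₃ e = begin
        sumF (λ l → u l * pr (q l))
          ≡⟨ sumF-cong (λ l → solve 7 (λ a b c w₁ w₂ w₃ x → (a :* w₁ :+ b :* w₂ :+ c :* w₃) :* x := a :* (w₁ :* x) :+ b :* (w₂ :* x) :+ c :* (w₃ :* x))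
                                      refl α β γ (w₁ l) (w₂ l) (w₃ l) (pr (q l))) ⟩
        sumF (λ l → α * (w₁ l * pr (q l)) + β * (w₂ l * pr (q l)) + γ * (w₃ l * pr (q l)))
          ≡⟨ sumF-lin₃ (λ l → w₁ l * pr (q l)) (λ l → w₂ l * pr (q l)) (λ l → w₃ l * pr (q l)) ⟩
        α * sumF (λ l → w₁ l * pr (q l)) + β * sumF (λ l → w₂ l * pr (q l)) + γ * sumF (λ l → w₃ l * pr (q l))
          ≡⟨ cong₃ e₁ e₂ e₃ ⟩
        α * pr z₁ + β * pr z₂ + γ * pr z₃ ≡⟨ sym e ⟩
        (α + β + γ) * pr z                ≡⟨ cong (_* pr z) (sym Σu≡) ⟩
        sumF u * pr z                     ∎
        where open ≡-Reasoning

    hull-split : ∀ {Bt B : Fin k → Bool} {z} t → B t ≡ false → (∀ l → Bt l ≡ true → l ≢ t → B l ≡ true) → InHull q Bt z →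
                 z ≡ q t ⊎ Σ ℝ λ s → Σ ℂ λ y → 0# ≤ s × s < 1# × InHull q B y × z ≡ lerp s y (q t)
    hull-split {Bt} {B} {z} t t∉B Bt⊆B+t (w , 0≤w , supp , Σw≡1 , Σwx≡ , Σwy≡) = split (compare s 1#)
      where
      s : ℝ
      s = w t
      w′ : Fin k → ℝ
      w′ = w without t
      0≤w′ : ∀ l → 0# ≤ w′ l
      0≤w′ l = by-cases (l Fin.≟ t)
        where
        by-cases : Dec (l ≡ t) → 0# ≤ w′ l
        by-cases (yes refl) = inj₂ (sym (without-at w t))
        by-cases (no  l≢t)  = subst (0# ≤_) (sym (without-off w t l l≢t)) (0≤w l)
      supp′ : ∀ l → B l ≡ false → w′ l ≡ 0#
      supp′ l l∉B = by-cases (l Fin.≟ t) (Bt l) refl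
        where
        by-cases : Dec (l ≡ t) → ∀ b → Bt l ≡ b → w′ l ≡ 0#
        by-cases (yes refl) _     _   = without-at w t
        by-cases (no  l≢t)  false Btl = trans (without-off w t l l≢t) (supp l Btl)
        by-cases (no  l≢t)  true  Btl = ⊥-elim (Bool.not-¬ (Bt⊆B+t l Btl l≢t) l∉B)
      Σw′≡1-s : sumF w′ ≡ 1# - s
      Σw′≡1-s = trans (sumF-cong {k} (λ l → sym (*-identityʳ (w′ l))))
                  (trans (sumF-without w t (λ _ → 1#)) (cong₂ _-_ (trans (sumF-cong {k} (λ l → *-identityʳ (w l))) Σw≡1) (*-identityʳ s)))
      z-split : ∀ (pr : ℂ → ℝ) → sumF (λ l → w l * pr (q l)) ≡ pr z → pr z ≡ sumF (λ l → w′ l * pr (q l)) + s * pr (q t)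
      z-split pr Σw·pr≡ = trans (sym Σw·pr≡) (trans (solve 2 (λ a b → a := a :- b :+ b) refl _ (s * pr (q t)))
                                                     (cong (_+ s * pr (q t)) (sym (sumF-without w t (pr ∘ q)))))
      split : Tri (s < 1#) (s ≡ 1#) (1# < s) →
              z ≡ q t ⊎ Σ ℝ λ s → Σ ℂ λ y → 0# ≤ s × s < 1# × InHull q B y × z ≡ lerp s y (q t)
      split (tri< s<1 _ _) =
        let (y , y∈B , Σw′x≡ , Σw′y≡) = hull-mean w′ 0≤w′ supp′ (subst (0# <_) (sym Σw′≡1-s) (x<y⇒0<y-x s<1))
        in inj₂ (s , y , 0≤w t , s<1 , y∈B , cong₂ _,_ (coord re {y} Σwx≡ Σw′x≡) (coord im {y} Σwy≡ Σw′y≡))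
        where
        coord : ∀ (pr : ℂ → ℝ) {y} → sumF (λ l → w l * pr (q l)) ≡ pr z → sumF (λ l → w′ l * pr (q l)) ≡ sumF w′ * pr y →
                pr z ≡ (1# - s) * pr y + s * pr (q t)
        coord pr {y} Σw·pr≡ Σw′·pr≡ = trans (z-split pr Σw·pr≡) (cong (_+ s * pr (q t)) (trans Σw′·pr≡ (cong (_* pr y) Σw′≡1-s)))
      split (tri≈ _ s≡1 _) = inj₁ (cong₂ _,_ (coord re Σwx≡) (coord im Σwy≡))
        where
        w′≡0 : ∀ l → w′ l ≡ 0#
        w′≡0 = sumF-nonNeg-≡0 0≤w′ (trans Σw′≡1-s (trans (cong (λ x → 1# - x) s≡1) (-‿inverseʳ 1#)))
        coord : ∀ (pr : ℂ → ℝ) → sumF (λ l → w l * pr (q l)) ≡ pr z → pr z ≡ pr (q t)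
        coord pr Σw·pr≡ = trans (z-split pr Σw·pr≡)
          (trans (cong₂ _+_ (sumF-zero (λ l → trans (cong (_* _) (w′≡0 l)) (zeroˡ _))) (cong (_* pr (q t)) s≡1))
                 (trans (+-identityˡ _) (*-identityˡ _)))
      split (tri> _ _ 1<s) = ⊥-elim (≤⇒≯ (subst (0# ≤_) Σw′≡1-s (sumF-nonNeg 0≤w′)) 1-s<0)
        where
        1-s<0 : 1# - s < 0#
        1-s<0 = 0<-x⇒x<0 (subst (0# <_) (solve 2 (λ s o → s :- o := :- (o :- s)) refl s 1#) (x<y⇒0<y-x 1<s))

    hull-on-segment : ∀ {C z} (τ : Fin k → ℝ) (u v : ℂ) → InHull q C z → (∀ l → C l ≡ true → q l ≡ lerp (τ l) u v) →
                      Σ ℝ λ T → z ≡ lerp T u v × (∀ lo → (∀ l → C l ≡ true → lo ≤ τ l) → lo ≤ T)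
                                              × (∀ hi → (∀ l → C l ≡ true → τ l ≤ hi) → T ≤ hi)
    hull-on-segment {C} {z} τ u v (w , 0≤w , supp , Σw≡1 , Σwx≡ , Σwy≡) q≡lerp =
      T , cong₂ _,_ (coord re (λ _ → refl) Σwx≡) (coord im (λ _ → refl) Σwy≡) , lower , upper
      where
      T : ℝ
      T = sumF (λ l → w l * τ l)
      sumF-affine : ∀ a b → sumF (λ l → w l * (a * τ l + b)) ≡ a * T + b
      sumF-affine a b = begin
        sumF (λ l → w l * (a * τ l + b))      ≡⟨ sumF-cong (λ l → solve 4 (λ w t a b → w :* (a :* t :+ b) := a :* (w :* t) :+ b :* w) refl (w l) (τ l) a b) ⟩
        sumF (λ l → a * (w l * τ l) + b * w l) ≡⟨ trans (sumF-+ (λ l → a * (w l * τ l)) (λ l → b * w l))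
                                                        (cong₂ _+_ (sumF-* a (λ l → w l * τ l)) (sumF-* b w)) ⟩
        a * T + b * sumF w                    ≡⟨ trans (cong (λ x → a * T + b * x) Σw≡1) (cong (a * T +_) (*-identityʳ b)) ⟩
        a * T + b                             ∎
        where open ≡-Reasoning
      on-support : ∀ {f g : Fin k → ℝ} → (∀ l → C l ≡ true → f l ≡ g l) → ∀ l → w l * f l ≡ w l * g l
      on-support f≡g l with C l in Cl
      ... | true  = cong (w l *_) (f≡g l Cl)
      ... | false = trans (cong (_* _) (supp l Cl)) (trans (zeroˡ _) (sym (trans (cong (_* _) (supp l Cl)) (zeroˡ _))))
      coord : ∀ (pr : ℂ → ℝ) → (∀ t → pr (lerp t u v) ≡ (1# - t) * pr u + t * pr v) →
              sumF (λ l → w l * pr (q l)) ≡ pr z → pr z ≡ (1# - T) * pr u + T * pr v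
      coord pr pr-lerp Σw·pr≡ = begin
        pr z                                               ≡⟨ sym Σw·pr≡ ⟩
        sumF (λ l → w l * pr (q l))                        ≡⟨ sumF-cong (on-support λ l l∈C →
                                                                trans (cong pr (q≡lerp l l∈C)) (trans (pr-lerp (τ l)) (affine (τ l)))) ⟩
        sumF (λ l → w l * ((pr v - pr u) * τ l + pr u))    ≡⟨ sumF-affine (pr v - pr u) (pr u) ⟩
        (pr v - pr u) * T + pr u                           ≡⟨ sym (affine T) ⟩
        (1# - T) * pr u + T * pr v                         ∎
        where
        open ≡-Reasoning
        affine : ∀ t → (1# - t) * pr u + t * pr v ≡ (pr v - pr u) * t + pr u
        affine t = solve 3 (λ t a b → (con (ℤ.+ 1) :- t) :* a :+ t :* b := (b :- a) :* t :+ a) refl t (pr u) (pr v)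
      lower : ∀ lo → (∀ l → C l ≡ true → lo ≤ τ l) → lo ≤ T
      lower lo lo≤τ = 0≤y-x⇒x≤y (subst (0# ≤_) (trans (sumF-affine 1# (- lo)) (cong (_- lo) (*-identityˡ T)))
        (sumF-nonNeg (supported-nonNeg 0≤w supp λ l l∈C → subst (0# ≤_) (cong (_- lo) (sym (*-identityˡ (τ l)))) (x≤y⇒0≤y-x (lo≤τ l l∈C)))))
      upper : ∀ hi → (∀ l → C l ≡ true → τ l ≤ hi) → T ≤ hi
      upper hi τ≤hi = 0≤y-x⇒x≤y (subst (0# ≤_) (trans (sumF-affine (- 1#) hi) (-1*T+hi T))
        (sumF-nonNeg (supported-nonNeg 0≤w supp λ l l∈C → subst (0# ≤_) (sym (-1*T+hi (τ l))) (x≤y⇒0≤y-x (τ≤hi l l∈C)))))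
        where
        -1*T+hi : ∀ t → - 1# * t + hi ≡ hi - t
        -1*T+hi t = solve 2 (λ t h → :- con (ℤ.+ 1) :* t :+ h := h :- t) refl t hi

    hull-segment : ∀ {A} (T lo hi : ℝ) (u v : ℂ) → lo < hi → lo ≤ T → T ≤ hi →
                   InHull q A (lerp lo u v) → InHull q A (lerp hi u v) → InHull q A (lerp T u v)
    hull-segment T lo hi u v lo<hi lo≤T T≤hi lo∈A hi∈A =
      hull-convex₃ (hi - T) (T - lo) 0# lo∈A hi∈A lo∈A (x≤y⇒0≤y-x T≤hi) (x≤y⇒0≤y-x lo≤T) ≤-refl
        (subst (0# <_) (solve 3 (λ t a b → b :- a := b :- t :+ (t :- a) :+ con (ℤ.+ 0)) refl T lo hi) (x<y⇒0<y-x lo<hi))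
        (interpolate (re u) (re v)) (interpolate (im u) (im v))
      where
      interpolate : ∀ x y → (hi - T + (T - lo) + 0#) * ((1# - T) * x + T * y)
                            ≡ (hi - T) * ((1# - lo) * x + lo * y) + (T - lo) * ((1# - hi) * x + hi * y) + 0# * ((1# - lo) * x + lo * y)
      interpolate x y = solve 5 (λ t a b x y →
        (b :- t :+ (t :- a) :+ con (ℤ.+ 0)) :* ((con (ℤ.+ 1) :- t) :* x :+ t :* y)
          := (b :- t) :* ((con (ℤ.+ 1) :- a) :* x :+ a :* y) :+ (t :- a) :* ((con (ℤ.+ 1) :- b) :* x :+ b :* y)
             :+ con (ℤ.+ 0) :* ((con (ℤ.+ 1) :- a) :* x :+ a :* y)) refl T lo hi x y

    hull-singleton : ∀ {A z} t → (∀ l → A l ≡ true → l ≡ t) → InHull q A z → z ≡ q t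
    hull-singleton t A⊆t h =
      let (T , z≡ , _) = hull-on-segment (λ _ → 0#) (q t) (q t) h (λ l l∈A → trans (cong q (A⊆t l l∈A)) (sym (lerp-0 (q t) (q t))))
      in trans z≡ (lerp-same T (q t))

  module _ {k : ℕ} (q : Fin (suc k) → ℂ) where

    hull-inject₁ : ∀ {A : Fin k → Bool} {A′ : Fin (suc k) → Bool} {z} → (∀ l → A′ (inject₁ l) ≡ A l) →
                   InHull (q ∘ inject₁) A z → InHull q A′ z
    hull-inject₁ {A} {A′} A′≡A (w , 0≤w , supp , Σw≡1 , Σwx≡ , Σwy≡) =
      W , 0≤W , supp′ , trans (sym (sumF-init W (∷ʳ-last w 0#))) (trans (sumF-cong (∷ʳ-inject₁ w 0#)) Σw≡1) ,
      extend (re ∘ q) Σwx≡ , extend (im ∘ q) Σwy≡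
      where
      W : Fin (suc k) → ℝ
      W = w ∷ʳ 0#
      0≤W : ∀ i → 0# ≤ W i
      0≤W i with inject₁-or-last i
      ... | inj₁ (l , refl) = subst (0# ≤_) (sym (∷ʳ-inject₁ w 0# l)) (0≤w l)
      ... | inj₂ refl       = inj₂ (sym (∷ʳ-last w 0#))
      supp′ : ∀ i → A′ i ≡ false → W i ≡ 0#
      supp′ i i∉A′ with inject₁-or-last i
      ... | inj₁ (l , refl) = trans (∷ʳ-inject₁ w 0# l) (supp l (trans (sym (A′≡A l)) i∉A′))
      ... | inj₂ refl       = ∷ʳ-last w 0#
      extend : ∀ (f : Fin (suc k) → ℝ) {c} → sumF (λ l → w l * f (inject₁ l)) ≡ c → sumF (λ i → W i * f i) ≡ c
      extend f Σ≡c = trans (sym (sumF-init (λ i → W i * f i) (trans (cong (_* _) (∷ʳ-last w 0#)) (zeroˡ _))))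
                           (trans (sumF-cong (λ l → cong (_* f (inject₁ l)) (∷ʳ-inject₁ w 0# l))) Σ≡c)

    hull-restrict : ∀ {A : Fin k → Bool} {A′ : Fin (suc k) → Bool} {z} → (∀ l → A′ (inject₁ l) ≡ A l) → A′ (fromℕ k) ≡ false →
                    InHull q A′ z → InHull (q ∘ inject₁) A z
    hull-restrict {A} {A′} A′≡A last∉A′ (W , 0≤W , supp , ΣW≡1 , ΣWx≡ , ΣWy≡) =
      W ∘ inject₁ , 0≤W ∘ inject₁ , (λ l l∉A → supp (inject₁ l) (trans (A′≡A l) l∉A)) ,
      trans (sumF-init W W-last≡0) ΣW≡1 , restrict (re ∘ q) ΣWx≡ , restrict (im ∘ q) ΣWy≡
      where
      W-last≡0 : W (fromℕ k) ≡ 0#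
      W-last≡0 = supp (fromℕ k) last∉A′
      restrict : ∀ (f : Fin (suc k) → ℝ) {c} → sumF (λ i → W i * f i) ≡ c → sumF (λ l → W (inject₁ l) * f (inject₁ l)) ≡ c
      restrict f = trans (sumF-init (λ i → W i * f i) (trans (cong (_* f (fromℕ k)) W-last≡0) (zeroˡ _)))

module Polygon (R : RealField) where

  open OrderedField R
  open Orientation R
  open FinLemmas
  open Geometry R
  open import Data.Nat as ℕ using (ℕ; suc; s≤s)
  import Data.Nat.Properties as ℕ
  open import Data.Integer as ℤ using ()
  open import Data.Fin as Fin using (toℕ)
  import Data.Fin.Properties as Fin
  open import Data.Product using (_×_; _,_)
  open import Data.Sum using (_⊎_; inj₁; inj₂)
  open import Data.Empty using (⊥-elim)
  open import Relation.Nullary using (yes; no)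
  open import Relation.Binary.PropositionalEquality

  InUnit : ℝ → Set
  InUnit t = 0# ≤ t × t ≤ 1#

  LexLe : ℕ → ℝ → ℕ → ℝ → Set
  LexLe e₁ s e₂ t = e₁ ℕ.< e₂ ⊎ (e₁ ≡ e₂ × s ≤ t)

  LexLt : ℕ → ℝ → ℕ → ℝ → Set
  LexLt e₁ s e₂ t = e₁ ℕ.< e₂ ⊎ (e₁ ≡ e₂ × s < t)

  LexLe⇒≤ : ∀ {e₁ s e₂ t} → LexLe e₁ s e₂ t → e₁ ℕ.≤ e₂
  LexLe⇒≤ (inj₁ e₁<e₂)       = ℕ.<⇒≤ e₁<e₂
  LexLe⇒≤ (inj₂ (refl , _)) = ℕ.≤-refl

  LexLt⇒LexLe : ∀ {e₁ s e₂ t} → LexLt e₁ s e₂ t → LexLe e₁ s e₂ t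
  LexLt⇒LexLe (inj₁ e₁<e₂)       = inj₁ e₁<e₂
  LexLt⇒LexLe (inj₂ (e₁≡e₂ , s<t)) = inj₂ (e₁≡e₂ , inj₁ s<t)

  -- Unless e₁ < e₂, the position (e₃ , r) lies beyond the closed edge e₁.
  LeavesEdge : ℕ → ℕ → ℕ → ℝ → Set
  LeavesEdge e₁ e₂ e₃ r = e₁ ℕ.< e₂ ⊎ (suc (suc e₁) ℕ.≤ e₃ ⊎ (suc e₁ ≡ e₃ × 0# < r))

  module ConvexPolygonProperties (K : ConvexPolygon) where
    open ConvexPolygon K

    N : ℕ
    N = suc (suc (suc m))

    V : ℕ → ℂ
    V i = vert (clamp i)

    clamp-injective : ∀ {i j} → i ℕ.< N → j ℕ.< N → clamp {suc (suc m)} i ≡ clamp j → i ≡ j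
    clamp-injective {i} {j} i<N j<N eq =
      trans (sym (toℕ-clamp i (ℕ.≤-pred i<N))) (trans (cong toℕ eq) (toℕ-clamp j (ℕ.≤-pred j<N)))

    cyc-clamp : ∀ i → suc i ℕ.< N → cyc (clamp {suc (suc m)} i) ≡ clamp (suc i)
    cyc-clamp i i+1<N = Fin.toℕ-injective (begin
      toℕ (cyc (clamp i)) ≡⟨ toℕ-cyc-< (clamp i) (subst (λ x → suc x ℕ.< N) (sym toℕ-i) i+1<N) ⟩
      suc (toℕ (clamp i)) ≡⟨ cong suc toℕ-i ⟩
      suc i               ≡⟨ sym (toℕ-clamp (suc i) (ℕ.≤-pred i+1<N)) ⟩
      toℕ (clamp (suc i)) ∎)
      where
      open ≡-Reasoning
      toℕ-i : toℕ (clamp {suc (suc m)} i) ≡ i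
      toℕ-i = toℕ-clamp i (ℕ.≤-pred (ℕ.<-trans (ℕ.n<1+n i) i+1<N))

    left-of-edge : ∀ i l → suc i ℕ.< N → l ℕ.< N → l ≢ i → l ≢ suc i → 0# < orient (V i) (V (suc i)) (V l)
    left-of-edge i l i+1<N l<N l≢i l≢i+1 =
      subst (λ v → 0# < orient (V i) v (V l)) (cong vert (cyc-clamp i i+1<N))
        (convex (clamp i) (clamp l) (λ eq → l≢i (clamp-injective l<N (ℕ.<-trans (ℕ.n<1+n i) i+1<N) eq))
                                    (λ eq → l≢i+1 (clamp-injective l<N i+1<N (trans eq (cyc-clamp i i+1<N)))))

    next : ℕ → ℂ
    next l = vert (cyc (clamp l))

    left-of-next-nonNeg : ∀ l x → x ℕ.< N → l ℕ.< N → x ≢ l → 0# ≤ orient (V l) (next l) (V x)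
    left-of-next-nonNeg l x x<N l<N x≢l with clamp {suc (suc m)} x Fin.≟ cyc (clamp l)
    ... | yes x≡l+1 = inj₂ (sym (trans (cong (λ v → orient (V l) (next l) (vert v)) x≡l+1) (orient-abb (V l) (next l))))
    ... | no  x≢l+1 = inj₁ (convex (clamp l) (clamp x) (λ eq → x≢l (clamp-injective x<N l<N eq)) x≢l+1)

    left-of-next-pos : ∀ l x → x ℕ.< N → l ℕ.< N → x ≢ l → x ≢ suc l → x ≢ 0 → 0# < orient (V l) (next l) (V x)
    left-of-next-pos l x x<N l<N x≢l x≢l+1 x≢0 =
      convex (clamp l) (clamp x) (λ eq → x≢l (clamp-injective x<N l<N eq)) x≢next
      where
      toℕ-x : toℕ (clamp {suc (suc m)} x) ≡ x
      toℕ-x = toℕ-clamp x (ℕ.≤-pred x<N)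
      x≢next : clamp x ≢ cyc (clamp l)
      x≢next eq with toℕ-cyc (clamp {suc (suc m)} l)
      ... | inj₁ next≡l+1 = x≢l+1 (trans (sym toℕ-x) (trans (cong toℕ eq) (trans next≡l+1 (cong suc (toℕ-clamp l (ℕ.≤-pred l<N))))))
      ... | inj₂ next≡0   = x≢0 (trans (sym toℕ-x) (trans (cong toℕ eq) next≡0))

    -- Induction on j. Otherwise the barycentric identity for V i, V j, V (suc j) and V l,
    -- against the functional of the edge leaving V l, would equate 0 with a positive sum.
    orient-vertices-pos : ∀ i j l → i ℕ.< j → j ℕ.< l → l ℕ.< N → 0# < orient (V i) (V j) (V l)
    orient-vertices-pos i (suc j) l (s≤s i≤j) j+1<l l<N with ℕ.m≤n⇒m<n∨m≡n i≤j
    ... | inj₂ refl = left-of-edge i l (ℕ.<-trans j+1<l l<N) l<N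
                        (λ l≡i → ℕ.<-irrefl (sym l≡i) (ℕ.<-trans (ℕ.n<1+n i) j+1<l)) (λ l≡i+1 → ℕ.<-irrefl (sym l≡i+1) j+1<l)
    ... | inj₁ i<j with ≤∨> (orient (V i) (V (suc j)) (V l)) 0#
    ...   | inj₂ 0<o = 0<o
    ...   | inj₁ o≤0 = ⊥-elim (<⇒≢ rhs-pos (sym lhs≡0))
      where
      a b c x : ℂ
      a = V i
      b = V j
      c = V (suc j)
      x = V l
      f : ℂ → ℝ
      f = orient (V l) (next l)
      j<l : j ℕ.< l
      j<l = ℕ.<-trans (ℕ.n<1+n j) j+1<l
      i<l : i ℕ.< l
      i<l = ℕ.<-trans i<j j<l
      lhs≡0 : orient a b c * f x ≡ 0#
      lhs≡0 = trans (cong (orient a b c *_) (orient-aba (V l) (next l))) (zeroʳ _)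
      term₁ : 0# ≤ orient x b c * f a
      term₁ = *-nonNeg (inj₁ (subst (0# <_) (sym (orient-rotate x b c))
                         (left-of-edge j l (ℕ.<-trans j+1<l l<N) l<N (λ l≡j → ℕ.<-irrefl (sym l≡j) j<l) (λ l≡j+1 → ℕ.<-irrefl (sym l≡j+1) j+1<l))))
                       (left-of-next-nonNeg l i (ℕ.<-trans i<l l<N) l<N (λ i≡l → ℕ.<-irrefl i≡l i<l))
      term₂ : 0# ≤ orient a x c * f b
      term₂ = *-nonNeg (subst (0# ≤_) (sym (orient-swap a c x)) (x≤0⇒0≤-x o≤0))
                       (left-of-next-nonNeg l j (ℕ.<-trans j<l l<N) l<N (λ j≡l → ℕ.<-irrefl j≡l j<l))
      term₃ : 0# < orient a b x * f c
      term₃ = *-pos (orient-vertices-pos i j l i<j j<l l<N)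
                    (left-of-next-pos l (suc j) (ℕ.<-trans j+1<l l<N) l<N (λ j+1≡l → ℕ.<-irrefl j+1≡l j+1<l)
                       (λ j+1≡l+1 → ℕ.<-irrefl (ℕ.suc-injective j+1≡l+1) j<l) (λ ()))
      rhs-pos : 0# < orient a b c * f x
      rhs-pos = subst (0# <_) (sym (orient-barycentric a b c x (V l) (next l))) (+-nonNeg-pos (+-nonNeg term₁ term₂) term₃)

    orient-vertices-nonNeg : ∀ i j l → i ℕ.≤ j → j ℕ.≤ l → l ℕ.< N → 0# ≤ orient (V i) (V j) (V l)
    orient-vertices-nonNeg i j l i≤j j≤l l<N with ℕ.m≤n⇒m<n∨m≡n i≤j | ℕ.m≤n⇒m<n∨m≡n j≤l
    ... | inj₂ refl | _         = inj₂ (sym (orient-aab _ _))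
    ... | inj₁ _    | inj₂ refl = inj₂ (sym (orient-abb _ _))
    ... | inj₁ i<j  | inj₁ j<l  = inj₁ (orient-vertices-pos i j l i<j j<l l<N)

    orient-edge-nonNeg : ∀ e l → e ℕ.≤ l → l ℕ.< N → 0# ≤ orient (V e) (V (suc e)) (V l)
    orient-edge-nonNeg e l e≤l l<N with ℕ.m≤n⇒m<n∨m≡n e≤l
    ... | inj₂ refl = inj₂ (sym (orient-aba _ _))
    ... | inj₁ e<l with ℕ.m≤n⇒m<n∨m≡n e<l
    ...   | inj₂ refl = inj₂ (sym (orient-abb _ _))
    ...   | inj₁ e+1<l = inj₁ (orient-vertices-pos e (suc e) l (ℕ.n<1+n e) e+1<l l<N)

    point : ℕ → ℝ → ℂ
    point e t = lerp t (V e) (V (suc e))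

    private
      1-r+r≡1 : ∀ r → 1# - r + r ≡ 1#
      1-r+r≡1 = solve 1 (λ r → con (ℤ.+ 1) :- r :+ r := con (ℤ.+ 1)) refl

      orient-same-edge : ∀ a e t r → orient a (point e t) (point e r) ≡ (r - t) * orient a (V e) (V (suc e))
      orient-same-edge a e t r = begin
        orient a (point e t) (point e r)       ≡⟨ orient-rotate a _ _ ⟩
        orient (point e t) (point e r) a       ≡⟨ orient-lerp-lerp t r (V e) (V (suc e)) a ⟩
        (r - t) * orient (V e) (V (suc e)) a   ≡⟨ cong ((r - t) *_) (sym (orient-rotate a (V e) (V (suc e)))) ⟩
        (r - t) * orient a (V e) (V (suc e))   ∎
        where open ≡-Reasoning

      nonNeg-vvp : ∀ α β e r → α ℕ.≤ β → β ℕ.≤ e → suc e ℕ.< N → InUnit r → 0# ≤ orient (V α) (V β) (point e r)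
      nonNeg-vvp α β e r α≤β β≤e e+1<N (0≤r , r≤1) = subst (0# ≤_) (sym (orient-lerp₃ (V α) (V β) r (V e) (V (suc e))))
        (+-nonNeg (*-nonNeg (x≤y⇒0≤y-x r≤1) (orient-vertices-nonNeg α β e α≤β β≤e (ℕ.<-trans (ℕ.n<1+n e) e+1<N)))
                  (*-nonNeg 0≤r (orient-vertices-nonNeg α β (suc e) α≤β (ℕ.m≤n⇒m≤1+n β≤e) e+1<N)))

      nonNeg-vpp : ∀ α e₂ t e₃ r → α ℕ.≤ e₂ → LexLe e₂ t e₃ r → suc e₃ ℕ.< N → InUnit t → InUnit r →
                   0# ≤ orient (V α) (point e₂ t) (point e₃ r)
      nonNeg-vpp α e₂ t e₃ r α≤e₂ (inj₁ e₂<e₃) e₃+1<N (0≤t , t≤1) r∈I =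
        subst (0# ≤_) (sym (orient-lerp₂ (V α) t (V e₂) (V (suc e₂)) (point e₃ r)))
          (+-nonNeg (*-nonNeg (x≤y⇒0≤y-x t≤1) (nonNeg-vvp α e₂ e₃ r α≤e₂ (ℕ.<⇒≤ e₂<e₃) e₃+1<N r∈I))
                    (*-nonNeg 0≤t (nonNeg-vvp α (suc e₂) e₃ r (ℕ.m≤n⇒m≤1+n α≤e₂) e₂<e₃ e₃+1<N r∈I)))
      nonNeg-vpp α e t e r α≤e (inj₂ (refl , t≤r)) e+1<N _ _ =
        subst (0# ≤_) (sym (orient-same-edge (V α) e t r))
          (*-nonNeg (x≤y⇒0≤y-x t≤r) (orient-vertices-nonNeg α e (suc e) α≤e (ℕ.n≤1+n e) e+1<N))

      pos-vvp : ∀ α β e r → α ℕ.< β → β ℕ.< e → suc e ℕ.< N → InUnit r → 0# < orient (V α) (V β) (point e r)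
      pos-vvp α β e r α<β β<e e+1<N (0≤r , r≤1) = subst (0# <_) (sym (orient-lerp₃ (V α) (V β) r (V e) (V (suc e))))
        (convex-comb-pos (x≤y⇒0≤y-x r≤1) 0≤r (1-r+r≡1 r)
          (orient-vertices-pos α β e α<β β<e (ℕ.<-trans (ℕ.n<1+n e) e+1<N))
          (orient-vertices-pos α β (suc e) α<β (ℕ.<-trans β<e (ℕ.n<1+n e)) e+1<N))

      pos-vpp : ∀ α e₂ t e₃ r → α ℕ.< e₂ → LexLt e₂ t e₃ r → t < 1# → suc e₃ ℕ.< N → InUnit t → InUnit r →
                0# < orient (V α) (point e₂ t) (point e₃ r)
      pos-vpp α e₂ t e₃ r α<e₂ (inj₁ e₂<e₃) t<1 e₃+1<N (0≤t , _) r∈I =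
        subst (0# <_) (sym (orient-lerp₂ (V α) t (V e₂) (V (suc e₂)) (point e₃ r)))
          (+-pos-nonNeg (*-pos (x<y⇒0<y-x t<1) (pos-vvp α e₂ e₃ r α<e₂ e₂<e₃ e₃+1<N r∈I))
                        (*-nonNeg 0≤t (nonNeg-vvp α (suc e₂) e₃ r (ℕ.<⇒≤ (ℕ.<-trans α<e₂ (ℕ.n<1+n e₂))) e₂<e₃ e₃+1<N r∈I)))
      pos-vpp α e t e r α<e (inj₂ (refl , t<r)) _ e+1<N _ _ =
        subst (0# <_) (sym (orient-same-edge (V α) e t r))
          (*-pos (x<y⇒0<y-x t<r) (orient-vertices-pos α e (suc e) α<e (ℕ.n<1+n e) e+1<N))

    orient-points-nonNeg : ∀ e₁ s e₂ t e₃ r → LexLe e₁ s e₂ t → LexLe e₂ t e₃ r → suc e₃ ℕ.< N →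
                           InUnit s → InUnit t → InUnit r → 0# ≤ orient (point e₁ s) (point e₂ t) (point e₃ r)
    orient-points-nonNeg e₁ s e₂ t e₃ r (inj₁ e₁<e₂) ≤₂₃ e₃+1<N (0≤s , s≤1) t∈I r∈I =
      subst (0# ≤_) (sym (orient-lerp₁ s (V e₁) (V (suc e₁)) (point e₂ t) (point e₃ r)))
        (+-nonNeg (*-nonNeg (x≤y⇒0≤y-x s≤1) (nonNeg-vpp e₁ e₂ t e₃ r (ℕ.<⇒≤ e₁<e₂) ≤₂₃ e₃+1<N t∈I r∈I))
                  (*-nonNeg 0≤s (nonNeg-vpp (suc e₁) e₂ t e₃ r e₁<e₂ ≤₂₃ e₃+1<N t∈I r∈I)))
    orient-points-nonNeg e s e t e₃ r (inj₂ (refl , s≤t)) ≤₂₃ e₃+1<N _ _ (0≤r , r≤1) =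
      subst (0# ≤_) (sym (trans (orient-lerp-lerp s t (V e) (V (suc e)) (point e₃ r))
                                (cong ((t - s) *_) (orient-lerp₃ (V e) (V (suc e)) r (V e₃) (V (suc e₃))))))
        (*-nonNeg (x≤y⇒0≤y-x s≤t)
          (+-nonNeg (*-nonNeg (x≤y⇒0≤y-x r≤1) (orient-edge-nonNeg e e₃ (LexLe⇒≤ ≤₂₃) (ℕ.<-trans (ℕ.n<1+n e₃) e₃+1<N)))
                    (*-nonNeg 0≤r (orient-edge-nonNeg e (suc e₃) (ℕ.m≤n⇒m≤1+n (LexLe⇒≤ ≤₂₃)) e₃+1<N))))

    orient-points-pos : ∀ e₁ s e₂ t e₃ r → LexLt e₁ s e₂ t → LexLt e₂ t e₃ r → s < 1# → t < 1# → LeavesEdge e₁ e₂ e₃ r →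
                        suc e₃ ℕ.< N → InUnit s → InUnit t → InUnit r → 0# < orient (point e₁ s) (point e₂ t) (point e₃ r)
    orient-points-pos e₁ s e₂ t e₃ r (inj₁ e₁<e₂) <₂₃ s<1 t<1 _ e₃+1<N (0≤s , _) t∈I r∈I =
      subst (0# <_) (sym (orient-lerp₁ s (V e₁) (V (suc e₁)) (point e₂ t) (point e₃ r)))
        (+-pos-nonNeg (*-pos (x<y⇒0<y-x s<1) (pos-vpp e₁ e₂ t e₃ r e₁<e₂ <₂₃ t<1 e₃+1<N t∈I r∈I))
                      (*-nonNeg 0≤s (nonNeg-vpp (suc e₁) e₂ t e₃ r e₁<e₂ (LexLt⇒LexLe <₂₃) e₃+1<N t∈I r∈I)))
    orient-points-pos e s e t e₃ r (inj₂ (refl , s<t)) _ _ _ leaves e₃+1<N _ _ (0≤r , r≤1) =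
      subst (0# <_) (sym (trans (orient-lerp-lerp s t (V e) (V (suc e)) (point e₃ r))
                                (cong ((t - s) *_) (orient-lerp₃ (V e) (V (suc e)) r (V e₃) (V (suc e₃))))))
        (*-pos (x<y⇒0<y-x s<t) (third-off-edge leaves))
      where
      third-off-edge : LeavesEdge e e e₃ r →
                       0# < (1# - r) * orient (V e) (V (suc e)) (V e₃) + r * orient (V e) (V (suc e)) (V (suc e₃))
      third-off-edge (inj₁ e<e) = ⊥-elim (ℕ.<-irrefl refl e<e)
      third-off-edge (inj₂ (inj₁ e+2≤e₃)) =
        convex-comb-pos (x≤y⇒0≤y-x r≤1) 0≤r (1-r+r≡1 r)
          (orient-vertices-pos e (suc e) e₃ (ℕ.n<1+n e) e+2≤e₃ (ℕ.<-trans (ℕ.n<1+n e₃) e₃+1<N))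
          (orient-vertices-pos e (suc e) (suc e₃) (ℕ.n<1+n e) (ℕ.m≤n⇒m≤1+n e+2≤e₃) e₃+1<N)
      third-off-edge (inj₂ (inj₂ (refl , 0<r))) =
        +-nonNeg-pos (*-nonNeg (x≤y⇒0≤y-x r≤1) (inj₂ (sym (orient-abb _ _))))
                     (*-pos 0<r (orient-vertices-pos e (suc e) (suc (suc e)) (ℕ.n<1+n e) (ℕ.n<1+n (suc e)) e₃+1<N))

module Boundary (R : RealField) where

  open OrderedField R
  open Orientation R
  open ConvexHull R
  open Polygon R
  open FinLemmas
  open Geometry R
  open import Data.Nat as ℕ using (ℕ; suc; s≤s)
  import Data.Nat.Properties as ℕ
  open import Data.Fin as Fin using (Fin; toℕ; inject₁; fromℕ)
  import Data.Fin.Properties as Fin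
  open import Data.Bool as Bool using (Bool; true; false)
  open import Data.Product using (Σ; _×_; _,_; proj₁; proj₂)
  open import Data.Sum using (_⊎_; inj₁; inj₂)
  open import Data.Empty using (⊥; ⊥-elim)
  open import Relation.Nullary using (¬_; yes; no)
  open import Relation.Nullary.Decidable using (_×-dec_)
  open import Relation.Binary.PropositionalEquality

  module Indices (m : ℕ) where
    pₙ pₙ₋₁ : Fin (suc (suc m))
    pₙ   = fromℕ (suc m)
    pₙ₋₁ = inject₁ (fromℕ m)

    toℕ-pₙ : toℕ pₙ ≡ suc m
    toℕ-pₙ = Fin.toℕ-fromℕ (suc m)

    toℕ-pₙ₋₁ : toℕ pₙ₋₁ ≡ m
    toℕ-pₙ₋₁ = trans (Fin.toℕ-inject₁ (fromℕ m)) (Fin.toℕ-fromℕ m)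

    <pₙ : ∀ i → i ≢ pₙ → toℕ i ℕ.< toℕ pₙ
    <pₙ i i≢pₙ = subst (toℕ i ℕ.<_) (sym toℕ-pₙ) (toℕ<k i i≢pₙ)

    ≤pₙ₋₁ : ∀ i → i ≢ pₙ → toℕ i ℕ.≤ toℕ pₙ₋₁
    ≤pₙ₋₁ i i≢pₙ = subst (toℕ i ℕ.≤_) (sym toℕ-pₙ₋₁) (ℕ.≤-pred (toℕ<k i i≢pₙ))

    pₙ₋₁≢pₙ : pₙ₋₁ ≢ pₙ
    pₙ₋₁≢pₙ eq = ℕ.<-irrefl (trans (sym toℕ-pₙ₋₁) (trans (cong toℕ eq) toℕ-pₙ)) (ℕ.n<1+n m)

    <⇒≢pₙ : ∀ {i j : Fin (suc (suc m))} → toℕ i ℕ.< toℕ j → i ≢ pₙ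
    <⇒≢pₙ {i} {j} i<j refl = ℕ.<-irrefl refl (ℕ.<-≤-trans (subst (ℕ._< toℕ j) toℕ-pₙ i<j) (ℕ.≤-pred (Fin.toℕ<n j)))

  module _ (K : ConvexPolygon) {m : ℕ} (p : Fin (suc (suc m)) → ℂ) where
    open ConvexPolygonProperties K
    open Indices m

    -- The points sit on the edges 0, …, k of the polygon in lexicographic order of
    -- (edge , param), with pₙ the vertex V (suc k) and `beyond` strictly left of edge k.
    record Parametrisation : Set where
      field
        k        : ℕ
        k+1<N    : suc k ℕ.< N
        edge     : Fin (suc (suc m)) → ℕ
        param    : Fin (suc (suc m)) → ℝ
        p≡point  : ∀ i → p i ≡ point (edge i) (param i)
        edge≤k   : ∀ i → edge i ℕ.≤ k
        param∈I  : ∀ i → InUnit (param i)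
        param<1  : ∀ i → i ≢ pₙ → param i < 1#
        edge-pₙ  : edge pₙ ≡ k
        param-pₙ : param pₙ ≡ 1#
        ordered  : ∀ i j → toℕ i ℕ.< toℕ j → LexLt (edge i) (param i) (edge j) (param j)
        beyond   : ℂ
        beyond-left : 0# < orient (V k) (V (suc k)) beyond

    module _ (par : Parametrisation) where
      open Parametrisation par

      orient-p : ∀ i j l → orient (p i) (p j) (p l) ≡ orient (point (edge i) (param i)) (point (edge j) (param j)) (point (edge l) (param l))
      orient-p i j l = trans (cong₂ (λ x y → orient x y (p l)) (p≡point i) (p≡point j)) (cong (orient _ _) (p≡point l))

      LexLe-index : ∀ i j → toℕ i ℕ.≤ toℕ j → LexLe (edge i) (param i) (edge j) (param j)
      LexLe-index i j i≤j with ℕ.m≤n⇒m<n∨m≡n i≤j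
      ... | inj₁ i<j = LexLt⇒LexLe (ordered i j i<j)
      ... | inj₂ i≡j with Fin.toℕ-injective {i = i} {j = j} i≡j
      ...   | refl = inj₂ (refl , ≤-refl)

      edge+1<N : ∀ i → suc (edge i) ℕ.< N
      edge+1<N i = ℕ.≤-<-trans (s≤s (edge≤k i)) k+1<N

      orient-nonNeg : ∀ i j l → toℕ i ℕ.≤ toℕ j → toℕ j ℕ.≤ toℕ l → 0# ≤ orient (p i) (p j) (p l)
      orient-nonNeg i j l i≤j j≤l = subst (0# ≤_) (sym (orient-p i j l))
        (orient-points-nonNeg (edge i) (param i) (edge j) (param j) (edge l) (param l)
          (LexLe-index i j i≤j) (LexLe-index j l j≤l) (edge+1<N l) (param∈I i) (param∈I j) (param∈I l))

      orient-pos : ∀ i j l → toℕ i ℕ.< toℕ j → toℕ j ℕ.< toℕ l → i ≢ pₙ → j ≢ pₙ →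
                   LeavesEdge (edge i) (edge j) (edge l) (param l) → 0# < orient (p i) (p j) (p l)
      orient-pos i j l i<j j<l i≢pₙ j≢pₙ leaves = subst (0# <_) (sym (orient-p i j l))
        (orient-points-pos (edge i) (param i) (edge j) (param j) (edge l) (param l) (ordered i j i<j) (ordered j l j<l)
          (param<1 i i≢pₙ) (param<1 j j≢pₙ) leaves (edge+1<N l) (param∈I i) (param∈I j) (param∈I l))

      u₀ v₀ : ℂ
      u₀ = V k
      v₀ = V (suc k)

      on-last-edge : ∀ i → edge i ≡ k → p i ≡ lerp (param i) u₀ v₀
      on-last-edge i edge≡k = trans (p≡point i) (cong (λ e → lerp (param i) (V e) (V (suc e))) edge≡k)

      p-pₙ : p pₙ ≡ v₀
      p-pₙ = trans (on-last-edge pₙ edge-pₙ) (trans (cong (λ t → lerp t u₀ v₀) param-pₙ) (lerp-1 u₀ v₀))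

      -- Lexicographically, first by the side of the last edge and then by the side of the
      -- line from the point to `beyond`, every other point is positive while pₙ is not.
      pₙ∉hull : ∀ (A : Fin (suc (suc m)) → Bool) → A pₙ ≡ false → ¬ InHull p A (p pₙ)
      pₙ∉hull A pₙ∉A pₙ∈hull = pₙ-not-lexPos (hull-lexPos p (orient-affine u₀ v₀) (orient-affine₁ v₀ beyond) pₙ∈hull lex-pos)
        where
        pₙ-not-lexPos : ¬ LexPos (orient u₀ v₀ (p pₙ)) (orient (p pₙ) v₀ beyond)
        pₙ-not-lexPos (inj₁ 0<F)       = <-irrefl (subst (0# <_) (trans (cong (orient u₀ v₀) p-pₙ) (orient-abb u₀ v₀)) 0<F)
        pₙ-not-lexPos (inj₂ (_ , 0<G)) = <-irrefl (subst (0# <_) (trans (cong (λ x → orient x v₀ beyond) p-pₙ) (orient-aab v₀ beyond)) 0<G)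
        lex-pos : ∀ l → A l ≡ true → LexPos (orient u₀ v₀ (p l)) (orient (p l) v₀ beyond)
        lex-pos l l∈A with ℕ.m≤n⇒m<n∨m≡n (edge≤k l)
        ... | inj₁ edge<k = inj₁ (subst (0# <_) (trans (cong₂ (λ x y → orient (point (edge l) (param l)) x y) (lerp-0 u₀ v₀) (lerp-1 u₀ v₀))
                                                      (trans (cong (λ x → orient x u₀ v₀) (sym (p≡point l))) (orient-rotate (p l) u₀ v₀)))
            (orient-points-pos (edge l) (param l) k 0# k 1# (inj₁ edge<k) (inj₂ (refl , 0<1)) (param<1 l (∈⇒≢ {A = A} l∈A pₙ∉A)) 0<1
              (inj₁ edge<k) k+1<N (param∈I l) (≤-refl , 0≤1) (0≤1 , ≤-refl)))
        ... | inj₂ edge≡k = inj₂ (on-edge , left-of-beyond)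
          where
          on-edge : orient u₀ v₀ (p l) ≡ 0#
          on-edge = trans (cong₂ (λ a b → orient a b (p l)) (sym (lerp-0 u₀ v₀)) (sym (lerp-1 u₀ v₀)))
                          (trans (cong (orient _ _) (on-last-edge l edge≡k)) (orient-collinear 0# 1# (param l) u₀ v₀))
          left-of-beyond : 0# < orient (p l) v₀ beyond
          left-of-beyond = subst (0# <_)
            (sym (trans (cong (λ x → orient x v₀ beyond) (on-last-edge l edge≡k))
                 (trans (orient-lerp₁ (param l) u₀ v₀ v₀ beyond)
                        (trans (cong ((1# - param l) * orient u₀ v₀ beyond +_) (trans (cong (param l *_) (orient-aab v₀ beyond)) (zeroʳ _)))
                               (+-identityʳ _)))))
            (*-pos (x<y⇒0<y-x (param<1 l (∈⇒≢ {A = A} l∈A pₙ∉A))) beyond-left)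

      HullsMeet : (Fin (suc (suc m)) → Bool) → (Fin (suc (suc m)) → Bool) → Set
      HullsMeet B C = Σ ℂ λ z → InHull p B z × InHull p C z

      edge-k-upward : ∀ {i j} → toℕ i ℕ.≤ toℕ j → edge i ≡ k → edge j ≡ k
      edge-k-upward {i} {j} i≤j edge-i≡k = ℕ.≤-antisym (edge≤k j) (subst (ℕ._≤ edge j) edge-i≡k (LexLe⇒≤ (LexLe-index i j i≤j)))

      param-< : ∀ {i j} → toℕ i ℕ.< toℕ j → edge i ≡ edge j → param i < param j
      param-< {i} {j} i<j same with ordered i j i<j
      ... | inj₁ edge-i<edge-j = ⊥-elim (ℕ.<-irrefl same edge-i<edge-j)
      ... | inj₂ (_ , param-i<param-j) = param-i<param-j

      param-≤ : ∀ {i j} → toℕ i ℕ.≤ toℕ j → edge i ≡ edge j → param i ≤ param j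
      param-≤ {i} {j} i≤j same with LexLe-index i j i≤j
      ... | inj₁ edge-i<edge-j = ⊥-elim (ℕ.<-irrefl same edge-i<edge-j)
      ... | inj₂ (_ , param-i≤param-j) = param-i≤param-j

      leaves-to-pₙ : ∀ e₁ e₂ → e₁ ℕ.< k → LeavesEdge e₁ e₂ (edge pₙ) (param pₙ)
      leaves-to-pₙ e₁ e₂ e₁<k with ℕ.m≤n⇒m<n∨m≡n e₁<k
      ... | inj₁ e₁+1<k  = inj₂ (inj₁ (subst (suc (suc e₁) ℕ.≤_) (sym edge-pₙ) e₁+1<k))
      ... | inj₂ e₁+1≡k = inj₂ (inj₂ (trans e₁+1≡k (sym edge-pₙ) , subst (0# <_) (sym param-pₙ) 0<1))

      interleaved-cases : ∀ c₁ a c₂ b → toℕ c₁ ℕ.< toℕ a → toℕ a ℕ.< toℕ c₂ → toℕ c₂ ℕ.< toℕ b →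
                          LeavesEdge (edge c₁) (edge a) (edge b) (param b) ⊎ (edge a ≡ edge c₁ × edge c₂ ≡ edge c₁)
      interleaved-cases c₁ a c₂ b c₁<a a<c₂ c₂<b with edge c₁ ℕ.<? edge a
      ... | yes e₁<eₐ = inj₁ (inj₁ e₁<eₐ)
      ... | no  e₁≮eₐ with suc (suc (edge c₁)) ℕ.≤? edge b
      ...   | yes e₁+2≤e_b = inj₁ (inj₂ (inj₁ e₁+2≤e_b))
      ...   | no  e₁+2≰e_b with ℕ.m≤n⇒m<n∨m≡n (ℕ.≤-pred (ℕ.≰⇒> e₁+2≰e_b))
      ...     | inj₁ e_b≤e₁ = inj₂ (eₐ≡e₁ , ℕ.≤-antisym (ℕ.≤-trans e₂≤e_b (ℕ.≤-pred e_b≤e₁)) (subst (ℕ._≤ edge c₂) eₐ≡e₁ eₐ≤e₂))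
        where
        eₐ≡e₁ : edge a ≡ edge c₁
        eₐ≡e₁ = ℕ.≤-antisym (ℕ.≮⇒≥ e₁≮eₐ) (LexLe⇒≤ (LexLe-index c₁ a (ℕ.<⇒≤ c₁<a)))
        eₐ≤e₂ : edge a ℕ.≤ edge c₂
        eₐ≤e₂ = LexLe⇒≤ (LexLe-index a c₂ (ℕ.<⇒≤ a<c₂))
        e₂≤e_b : edge c₂ ℕ.≤ edge b
        e₂≤e_b = LexLe⇒≤ (LexLe-index c₂ b (ℕ.<⇒≤ c₂<b))
      ...     | inj₂ e_b≡e₁+1 with ≤∨> (param b) 0#
      ...       | inj₂ 0<param-b = inj₁ (inj₂ (inj₂ (sym e_b≡e₁+1 , 0<param-b)))
      ...       | inj₁ param-b≤0 = inj₂ (eₐ≡e₁ , ℕ.≤-antisym (ℕ.≤-pred e₂<e₁+1) (subst (ℕ._≤ edge c₂) eₐ≡e₁ eₐ≤e₂))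
        where
        eₐ≡e₁ : edge a ≡ edge c₁
        eₐ≡e₁ = ℕ.≤-antisym (ℕ.≮⇒≥ e₁≮eₐ) (LexLe⇒≤ (LexLe-index c₁ a (ℕ.<⇒≤ c₁<a)))
        eₐ≤e₂ : edge a ℕ.≤ edge c₂
        eₐ≤e₂ = LexLe⇒≤ (LexLe-index a c₂ (ℕ.<⇒≤ a<c₂))
        e₂<e₁+1 : edge c₂ ℕ.< suc (edge c₁)
        e₂<e₁+1 with ℕ.m≤n⇒m<n∨m≡n (LexLe⇒≤ (LexLe-index c₂ b (ℕ.<⇒≤ c₂<b)))
        ... | inj₁ e₂<e_b  = subst (edge c₂ ℕ.<_) e_b≡e₁+1 e₂<e_b
        ... | inj₂ e₂≡e_b = ⊥-elim (≤⇒≯ (proj₁ (param∈I c₂)) (<-≤-trans (param-< c₂<b e₂≡e_b) param-b≤0))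

      crossing-meet : ∀ {B C : Fin (suc (suc m)) → Bool} c₁ a c₂ b → B a ≡ true → B b ≡ true → C c₁ ≡ true → C c₂ ≡ true →
                      toℕ c₁ ℕ.≤ toℕ a → toℕ a ℕ.≤ toℕ c₂ → toℕ c₂ ℕ.≤ toℕ b → 0# < orient (p c₁) (p a) (p b) → HullsMeet B C
      crossing-meet {B} {C} c₁ a c₂ b a∈B b∈B c₁∈C c₂∈C c₁≤a a≤c₂ c₂≤b 0<w₂ = x , x∈hull-B , x∈hull-C
        where
        w₁ w₂ : ℝ
        w₁ = orient (p a) (p c₂) (p b)
        w₂ = orient (p c₁) (p a) (p b)
        0≤w₁ : 0# ≤ w₁
        0≤w₁ = orient-nonNeg a c₂ b a≤c₂ c₂≤b
        0<w : 0# < w₁ + w₂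
        0<w = +-nonNeg-pos 0≤w₁ 0<w₂
        c : ℝ
        c = (w₁ + w₂) ⁻¹⟨ 0<w ⟩
        x : ℂ
        x = ((w₁ * re (p c₁) + w₂ * re (p c₂)) * c , (w₁ * im (p c₁) + w₂ * im (p c₂)) * c)
        scale : ∀ y y₀ → (w₁ + w₂ + 0#) * (y * c) ≡ y + 0# * y₀
        scale y y₀ = begin
          (w₁ + w₂ + 0#) * (y * c) ≡⟨ cong₂ _*_ (+-identityʳ _) (*-comm y c) ⟩
          (w₁ + w₂) * (c * y)      ≡⟨ sym (*-assoc _ c y) ⟩
          (w₁ + w₂) * c * y        ≡⟨ cong (_* y) (*-inverseʳ _ 0<w) ⟩
          1# * y                   ≡⟨ *-identityˡ y ⟩
          y                        ≡⟨ sym (trans (cong (y +_) (zeroˡ y₀)) (+-identityʳ y)) ⟩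
          y + 0# * y₀              ∎
          where open ≡-Reasoning
        x∈hull-C : InHull p C x
        x∈hull-C = hull-convex₃ p w₁ w₂ 0# (hull-point p c₁ c₁∈C) (hull-point p c₂ c₂∈C) (hull-point p c₁ c₁∈C)
                     0≤w₁ (inj₁ 0<w₂) ≤-refl (subst (0# <_) (sym (+-identityʳ _)) 0<w) (scale _ _) (scale _ _)
        w≡ : orient (p c₁) (p c₂) (p b) + orient (p c₁) (p a) (p c₂) ≡ w₁ + w₂
        w≡ = sym (orient-crossing (p c₁) (p c₂) (p a) (p b))
        x∈hull-B : InHull p B x
        x∈hull-B = hull-convex₃ p (orient (p c₁) (p c₂) (p b)) (orient (p c₁) (p a) (p c₂)) 0#
                     (hull-point p a a∈B) (hull-point p b b∈B) (hull-point p a a∈B)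
                     (orient-nonNeg c₁ c₂ b (ℕ.≤-trans c₁≤a a≤c₂) c₂≤b) (orient-nonNeg c₁ a c₂ c₁≤a a≤c₂) ≤-refl
                     (subst (0# <_) (sym (trans (+-identityʳ _) w≡)) 0<w)
                     (trans (cong (λ w → (w + 0#) * re x) w≡)
                            (trans (scale _ (re (p a))) (cong (_+ 0# * re (p a)) (orient-crossing-re (p c₁) (p c₂) (p a) (p b)))))
                     (trans (cong (λ w → (w + 0#) * im x) w≡)
                            (trans (scale _ (im (p a))) (cong (_+ 0# * im (p a)) (orient-crossing-im (p c₁) (p c₂) (p a) (p b)))))

      collinear-meet : ∀ {B C : Fin (suc (suc m)) → Bool} c₁ a c₂ → B a ≡ true → C c₁ ≡ true → C c₂ ≡ true →
                       toℕ c₁ ℕ.< toℕ a → toℕ a ℕ.< toℕ c₂ → edge a ≡ edge c₁ → edge c₂ ≡ edge c₁ → HullsMeet B C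
      collinear-meet {B} {C} c₁ a c₂ a∈B c₁∈C c₂∈C c₁<a a<c₂ eₐ≡e₁ e₂≡e₁ =
        p a , hull-point p a a∈B ,
        subst (InHull p C) (sym (on-edge a eₐ≡e₁))
          (hull-segment p (param a) (param c₁) (param c₂) (V (edge c₁)) (V (suc (edge c₁)))
            (<-trans c₁<a′ a<c₂′) (inj₁ c₁<a′) (inj₁ a<c₂′)
            (subst (InHull p C) (on-edge c₁ refl) (hull-point p c₁ c₁∈C))
            (subst (InHull p C) (on-edge c₂ e₂≡e₁) (hull-point p c₂ c₂∈C)))
        where
        on-edge : ∀ l → edge l ≡ edge c₁ → p l ≡ lerp (param l) (V (edge c₁)) (V (suc (edge c₁)))
        on-edge l eₗ≡e₁ = trans (p≡point l) (cong (λ e → lerp (param l) (V e) (V (suc e))) eₗ≡e₁)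
        c₁<a′ : param c₁ < param a
        c₁<a′ = param-< c₁<a (sym eₐ≡e₁)
        a<c₂′ : param a < param c₂
        a<c₂′ = param-< a<c₂ (trans eₐ≡e₁ (sym e₂≡e₁))

      chords-meet : ∀ {B C : Fin (suc (suc m)) → Bool} c₁ a c₂ b → B a ≡ true → B b ≡ true → C c₁ ≡ true → C c₂ ≡ true →
                    toℕ c₁ ℕ.< toℕ a → toℕ a ℕ.< toℕ c₂ → toℕ c₂ ℕ.< toℕ b → HullsMeet B C
      chords-meet c₁ a c₂ b a∈B b∈B c₁∈C c₂∈C c₁<a a<c₂ c₂<b with interleaved-cases c₁ a c₂ b c₁<a a<c₂ c₂<b
      ... | inj₁ leaves = crossing-meet c₁ a c₂ b a∈B b∈B c₁∈C c₂∈C (ℕ.<⇒≤ c₁<a) (ℕ.<⇒≤ a<c₂) (ℕ.<⇒≤ c₂<b)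
                            (orient-pos c₁ a b c₁<a a<b (<⇒≢pₙ (ℕ.<-trans c₁<a a<b)) (<⇒≢pₙ a<b) leaves)
        where
        a<b : toℕ a ℕ.< toℕ b
        a<b = ℕ.<-trans a<c₂ c₂<b
      ... | inj₂ (eₐ≡e₁ , e₂≡e₁) = collinear-meet c₁ a c₂ a∈B c₁∈C c₂∈C c₁<a a<c₂ eₐ≡e₁ e₂≡e₁

      module _ {B B⁺ C : Fin (suc (suc m)) → Bool} (pₙ∉B : B pₙ ≡ false) (pₙ∉C : C pₙ ≡ false)
               (B⁺⊆B+pₙ : ∀ l → B⁺ l ≡ true → l ≢ pₙ → B l ≡ true)
               {a : Fin (suc (suc m))} (a∈B : B a ≡ true) (a≤B : ∀ b → B b ≡ true → toℕ a ℕ.≤ toℕ b) where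

        private
          B≤pₙ₋₁ : ∀ b → B b ≡ true → toℕ b ℕ.≤ toℕ pₙ₋₁
          B≤pₙ₋₁ b b∈B = ≤pₙ₋₁ b (∈⇒≢ {A = B} b∈B pₙ∉B)

          a≢pₙ : a ≢ pₙ
          a≢pₙ = ∈⇒≢ {A = B} a∈B pₙ∉B

        private
          a<pₙ₋₁ : ∀ {z} → (∀ l → C l ≡ true → toℕ a ℕ.< toℕ l × toℕ l ℕ.< toℕ pₙ₋₁) → InHull p C z → toℕ a ℕ.< toℕ pₙ₋₁
          a<pₙ₋₁ C-between z∈C with hull-inhabited p z∈C
          ... | l , l∈C = ℕ.<-trans (proj₁ (C-between l l∈C)) (proj₂ (C-between l l∈C))

          ℓ : ℂ → ℝ
          ℓ = orient (p a) (p pₙ₋₁)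

          ℓ≤0-on-B : ∀ l → B l ≡ true → ℓ (p l) ≤ 0#
          ℓ≤0-on-B l l∈B = subst (_≤ 0#) (sym (orient-swap (p a) (p l) (p pₙ₋₁)))
                             (0≤x⇒-x≤0 (orient-nonNeg a l pₙ₋₁ (a≤B l l∈B) (B≤pₙ₋₁ l l∈B)))

        -- The line through p a and p pₙ₋₁ has C and y on one side and p pₙ on the other,
        -- which puts z in the triangle y, p a, p pₙ₋₁.
        triangle-meet : ∀ {y z s} → B pₙ₋₁ ≡ true → toℕ a ℕ.< toℕ pₙ₋₁ → edge a ℕ.< k → (∀ l → C l ≡ true → ℓ (p l) ≤ 0#) →
                        InHull p C z → InHull p B y → 0# ≤ s → z ≡ lerp s y (p pₙ) → HullsMeet B C
        triangle-meet {y} {z} {s} pₙ₋₁∈B a<pₙ₋₁ eₐ<k ℓ≤0-on-C z∈C y∈B 0≤s z≡ =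
          by-sign (hull-nonPos p (orient-affine (p a) (p pₙ₋₁)) y∈B ℓ≤0-on-B)
          where
          ℓz≤0 : ℓ z ≤ 0#
          ℓz≤0 = hull-nonPos p (orient-affine (p a) (p pₙ₋₁)) z∈C ℓ≤0-on-C

          0<ℓpₙ : 0# < ℓ (p pₙ)
          0<ℓpₙ = orient-pos a pₙ₋₁ pₙ a<pₙ₋₁ (<pₙ pₙ₋₁ pₙ₋₁≢pₙ) a≢pₙ pₙ₋₁≢pₙ (leaves-to-pₙ (edge a) (edge pₙ₋₁) eₐ<k)

          s≡0 : ℓ y ≡ 0# → s ≡ 0#
          s≡0 ℓy≡0 = s≡0′ 0≤s
            where
            ℓz≡s*ℓpₙ : ℓ z ≡ s * ℓ (p pₙ)
            ℓz≡s*ℓpₙ = trans (cong ℓ z≡) (trans (orient-lerp₃ (p a) (p pₙ₋₁) s y (p pₙ))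
                         (trans (cong (λ w → (1# - s) * w + s * ℓ (p pₙ)) ℓy≡0) (trans (cong (_+ s * ℓ (p pₙ)) (zeroʳ _)) (+-identityˡ _))))
            s≡0′ : 0# ≤ s → s ≡ 0#
            s≡0′ (inj₂ 0≡s) = sym 0≡s
            s≡0′ (inj₁ 0<s) = ⊥-elim (≤⇒≯ (subst (_≤ 0#) ℓz≡s*ℓpₙ ℓz≤0) (*-pos 0<s 0<ℓpₙ))

          pₙ₋₁≤pₙ : toℕ pₙ₋₁ ℕ.≤ toℕ pₙ
          pₙ₋₁≤pₙ = ℕ.<⇒≤ (<pₙ pₙ₋₁ pₙ₋₁≢pₙ)

          z∈B : ℓ y < 0# → InHull p B (lerp s y (p pₙ))
          z∈B ℓy<0 = hull-convex₃ p (- ℓ (lerp s y (p pₙ))) (s * orient (p pₙ₋₁) (p pₙ) y) (s * orient (p pₙ) (p a) y)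
            y∈B (hull-point p a a∈B) (hull-point p pₙ₋₁ pₙ₋₁∈B)
            (x≤0⇒0≤-x (subst (λ w → ℓ w ≤ 0#) z≡ ℓz≤0))
            (*-nonNeg 0≤s (hull-nonNeg p (orient-affine (p pₙ₋₁) (p pₙ)) y∈B λ l l∈B →
               subst (0# ≤_) (orient-rotate (p l) (p pₙ₋₁) (p pₙ)) (orient-nonNeg l pₙ₋₁ pₙ (B≤pₙ₋₁ l l∈B) pₙ₋₁≤pₙ)))
            (*-nonNeg 0≤s (hull-nonNeg p (orient-affine (p pₙ) (p a)) y∈B λ l l∈B →
               subst (0# ≤_) (sym (orient-rotate (p pₙ) (p a) (p l)))
                     (orient-nonNeg a l pₙ (a≤B l l∈B) (ℕ.<⇒≤ (<pₙ l (∈⇒≢ {A = B} l∈B pₙ∉B))))))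
            (subst (0# <_) (sym (lerp-in-triangle (p a) (p pₙ₋₁) (p pₙ) y s)) (x<0⇒0<-x ℓy<0))
            (lerp-in-triangle-re (p a) (p pₙ₋₁) (p pₙ) y s) (lerp-in-triangle-im (p a) (p pₙ₋₁) (p pₙ) y s)

          by-sign : ℓ y ≤ 0# → HullsMeet B C
          by-sign (inj₁ ℓy<0) = z , subst (InHull p B) (sym z≡) (z∈B ℓy<0) , z∈C
          by-sign (inj₂ ℓy≡0) =
            z , subst (InHull p B) (sym (trans z≡ (trans (cong (λ t → lerp t y (p pₙ)) (s≡0 ℓy≡0)) (lerp-0 y (p pₙ))))) y∈B , z∈C

        last-edge-meet : ∀ {z} → B pₙ₋₁ ≡ true → edge a ≡ k → (∀ l → C l ≡ true → toℕ a ℕ.< toℕ l × toℕ l ℕ.< toℕ pₙ₋₁) →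
                         toℕ a ℕ.< toℕ pₙ₋₁ → InHull p C z → HullsMeet B C
        last-edge-meet {z} pₙ₋₁∈B eₐ≡k C-between a<pₙ₋₁ z∈C =
          let (T , z≡ , lower , upper) = hull-on-segment p param u₀ v₀ z∈C (λ l l∈C → on-last-edge l (eₗ≡k l l∈C))
          in z , subst (InHull p B) (sym z≡) (segment⊆B T (lower (param a) a≤C) (upper (param pₙ₋₁) C≤pₙ₋₁)) , z∈C
          where
          eₗ≡k : ∀ l → C l ≡ true → edge l ≡ k
          eₗ≡k l l∈C = edge-k-upward (ℕ.<⇒≤ (proj₁ (C-between l l∈C))) eₐ≡k
          eₚ≡k : edge pₙ₋₁ ≡ k
          eₚ≡k = edge-k-upward (ℕ.<⇒≤ a<pₙ₋₁) eₐ≡k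
          a≤C : ∀ l → C l ≡ true → param a ≤ param l
          a≤C l l∈C = inj₁ (param-< (proj₁ (C-between l l∈C)) (trans eₐ≡k (sym (eₗ≡k l l∈C))))
          C≤pₙ₋₁ : ∀ l → C l ≡ true → param l ≤ param pₙ₋₁
          C≤pₙ₋₁ l l∈C = inj₁ (param-< (proj₂ (C-between l l∈C)) (trans (eₗ≡k l l∈C) (sym eₚ≡k)))
          segment⊆B : ∀ T → param a ≤ T → T ≤ param pₙ₋₁ → InHull p B (lerp T u₀ v₀)
          segment⊆B T a≤T T≤pₙ₋₁ = hull-segment p T (param a) (param pₙ₋₁) u₀ v₀ (param-< a<pₙ₋₁ (trans eₐ≡k (sym eₚ≡k))) a≤T T≤pₙ₋₁
            (subst (InHull p B) (on-last-edge a eₐ≡k) (hull-point p a a∈B))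
            (subst (InHull p B) (on-last-edge pₙ₋₁ eₚ≡k) (hull-point p pₙ₋₁ pₙ₋₁∈B))

        ¬meet-between : B pₙ₋₁ ≡ true → (∀ l → C l ≡ true → toℕ a ℕ.< toℕ l × toℕ l ℕ.< toℕ pₙ₋₁) →
                        ¬ HullsMeet B C → ¬ HullsMeet B⁺ C
        ¬meet-between pₙ₋₁∈B C-between ¬meet (z , z∈B⁺ , z∈C) = by-edge (ℕ.m≤n⇒m<n∨m≡n (edge≤k a))
          where
          ℓ≤0-on-C : ∀ l → C l ≡ true → ℓ (p l) ≤ 0#
          ℓ≤0-on-C l l∈C = subst (_≤ 0#) (sym (orient-swap (p a) (p l) (p pₙ₋₁)))
            (0≤x⇒-x≤0 (orient-nonNeg a l pₙ₋₁ (ℕ.<⇒≤ (proj₁ (C-between l l∈C))) (ℕ.<⇒≤ (proj₂ (C-between l l∈C)))))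
          split : edge a ℕ.< k → z ≡ p pₙ ⊎ (Σ ℝ λ s → Σ ℂ λ y → 0# ≤ s × s < 1# × InHull p B y × z ≡ lerp s y (p pₙ)) → ⊥
          split _   (inj₁ z≡pₙ) = pₙ∉hull C pₙ∉C (subst (InHull p C) z≡pₙ z∈C)
          split eₐ<k (inj₂ (s , y , 0≤s , _ , y∈B , z≡)) =
            ¬meet (triangle-meet pₙ₋₁∈B (a<pₙ₋₁ C-between z∈C) eₐ<k ℓ≤0-on-C z∈C y∈B 0≤s z≡)
          by-edge : edge a ℕ.< k ⊎ edge a ≡ k → ⊥
          by-edge (inj₁ eₐ<k) = split eₐ<k (hull-split p pₙ pₙ∉B B⁺⊆B+pₙ z∈B⁺)
          by-edge (inj₂ eₐ≡k) = ¬meet (last-edge-meet pₙ₋₁∈B eₐ≡k C-between (a<pₙ₋₁ C-between z∈C) z∈C)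

        -- The line through p a and p pₙ separates C from B⁺; when a lies on the last edge
        -- that line is the last edge, and the line from the point to `beyond` breaks the tie.
        module _ (C<a : ∀ l → C l ≡ true → toℕ l ℕ.< toℕ a) where
          private
            F G : ℂ → ℝ
            F = orient (p a) (p pₙ)
            G x = orient x (p a) beyond

            a≤B⁺ : ∀ l → B⁺ l ≡ true → toℕ a ℕ.≤ toℕ l
            a≤B⁺ l l∈B⁺ with l Fin.≟ pₙ
            ... | yes refl = ℕ.<⇒≤ (<pₙ a a≢pₙ)
            ... | no  l≢pₙ = a≤B l (B⁺⊆B+pₙ l l∈B⁺ l≢pₙ)

            ≤pₙ : ∀ l → toℕ l ℕ.≤ toℕ pₙ
            ≤pₙ l = subst (toℕ l ℕ.≤_) (sym toℕ-pₙ) (ℕ.≤-pred (Fin.toℕ<n l))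

            F≤0-on-B⁺ : ∀ l → B⁺ l ≡ true → F (p l) ≤ 0#
            F≤0-on-B⁺ l l∈B⁺ = subst (_≤ 0#) (sym (orient-swap (p a) (p l) (p pₙ)))
                                  (0≤x⇒-x≤0 (orient-nonNeg a l pₙ (a≤B⁺ l l∈B⁺) (≤pₙ l)))

            0<F-on-C : ∀ l → C l ≡ true → edge l ℕ.< k → 0# < F (p l)
            0<F-on-C l l∈C eₗ<k = subst (0# <_) (orient-rotate (p l) (p a) (p pₙ))
              (orient-pos l a pₙ (C<a l l∈C) (<pₙ a a≢pₙ) (∈⇒≢ {A = C} l∈C pₙ∉C) a≢pₙ (leaves-to-pₙ (edge l) (edge a) eₗ<k))

            on-last-edge-F≡0 : ∀ l → edge a ≡ k → edge l ≡ k → F (p l) ≡ 0#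
            on-last-edge-F≡0 l eₐ≡k eₗ≡k =
              trans (cong₂ (λ x y → orient x y (p l)) (on-last-edge a eₐ≡k) (on-last-edge pₙ edge-pₙ))
                    (trans (cong (orient _ _) (on-last-edge l eₗ≡k)) (orient-collinear (param a) (param pₙ) (param l) u₀ v₀))

            on-last-edge-G : ∀ l → edge a ≡ k → edge l ≡ k → G (p l) ≡ (param a - param l) * orient u₀ v₀ beyond
            on-last-edge-G l eₐ≡k eₗ≡k = trans (cong₂ (λ x y → orient x y beyond) (on-last-edge l eₗ≡k) (on-last-edge a eₐ≡k))
                                               (orient-lerp-lerp (param l) (param a) u₀ v₀ beyond)

          ¬meet-before : ¬ HullsMeet B⁺ C
          ¬meet-before (z , z∈B⁺ , z∈C) with ℕ.m≤n⇒m<n∨m≡n (edge≤k a)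
          ... | inj₁ eₐ<k = ≤⇒≯ (hull-nonPos p (orient-affine (p a) (p pₙ)) z∈B⁺ F≤0-on-B⁺)
                                (hull-pos p (orient-affine (p a) (p pₙ)) z∈C λ l l∈C →
                                   0<F-on-C l l∈C (ℕ.≤-<-trans (LexLe⇒≤ (LexLe-index l a (ℕ.<⇒≤ (C<a l l∈C)))) eₐ<k))
          ... | inj₂ eₐ≡k = not-lexPos (hull-lexPos p (orient-affine (p a) (p pₙ)) (orient-affine₁ (p a) beyond) z∈C lexPos-on-C)
            where
            lexPos-on-C : ∀ l → C l ≡ true → LexPos (F (p l)) (G (p l))
            lexPos-on-C l l∈C with ℕ.m≤n⇒m<n∨m≡n (edge≤k l)
            ... | inj₁ eₗ<k = inj₁ (0<F-on-C l l∈C eₗ<k)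
            ... | inj₂ eₗ≡k = inj₂ (on-last-edge-F≡0 l eₐ≡k eₗ≡k , subst (0# <_) (sym (on-last-edge-G l eₐ≡k eₗ≡k))
                                     (*-pos (x<y⇒0<y-x (param-< (C<a l l∈C) (trans eₗ≡k (sym eₐ≡k)))) beyond-left))
            G≤0-on-B⁺ : ∀ l → B⁺ l ≡ true → G (p l) ≤ 0#
            G≤0-on-B⁺ l l∈B⁺ = subst (_≤ 0#) (sym (on-last-edge-G l eₐ≡k eₗ≡k))
              (*-nonNeg-nonPos′ (param-≤ (a≤B⁺ l l∈B⁺) (trans eₐ≡k (sym eₗ≡k))) (inj₁ beyond-left))
              where
              eₗ≡k = edge-k-upward (a≤B⁺ l l∈B⁺) eₐ≡k
              *-nonNeg-nonPos′ : ∀ {x y t} → x ≤ y → 0# ≤ t → (x - y) * t ≤ 0#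
              *-nonNeg-nonPos′ {x} {y} {t} x≤y 0≤t = subst (_≤ 0#) (*-comm t (x - y))
                (*-nonNeg-nonPos 0≤t (0≤-x⇒x≤0 (subst (0# ≤_) (solve 2 (λ x y → y :- x := :- (x :- y)) refl x y) (x≤y⇒0≤y-x x≤y))))
            not-lexPos : ¬ LexPos (F z) (G z)
            not-lexPos (inj₁ 0<Fz)       = ≤⇒≯ (hull-nonPos p (orient-affine (p a) (p pₙ)) z∈B⁺ F≤0-on-B⁺) 0<Fz
            not-lexPos (inj₂ (_ , 0<Gz)) = ≤⇒≯ (hull-nonPos p (orient-affine₁ (p a) beyond) z∈B⁺ G≤0-on-B⁺) 0<Gz

      join-pₙ-keeps-¬meet : ∀ {B B⁺ C : Fin (suc (suc m)) → Bool} → B pₙ ≡ false → C pₙ ≡ false → B pₙ₋₁ ≡ true →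
                            (∀ l → B⁺ l ≡ true → l ≢ pₙ → B l ≡ true) → ¬ HullsMeet B C → ¬ HullsMeet B⁺ C
      join-pₙ-keeps-¬meet {B} {B⁺} {C} pₙ∉B pₙ∉C pₙ₋₁∈B B⁺⊆B+pₙ ¬meet with least-index B pₙ₋₁ pₙ₋₁∈B
      ... | a , a∈B , a≤B = split-at-a
        where
        B∩C≡∅ : ∀ b l → B b ≡ true → C l ≡ true → l ≢ b
        B∩C≡∅ b l b∈B l∈C refl = ¬meet (p l , hull-point p l b∈B , hull-point p l l∈C)
        C<pₙ₋₁ : ∀ l → C l ≡ true → toℕ l ℕ.< toℕ pₙ₋₁
        C<pₙ₋₁ l l∈C = ℕ.≤∧≢⇒< (≤pₙ₋₁ l (∈⇒≢ {A = C} l∈C pₙ∉C))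
                              (λ l≡pₙ₋₁ → B∩C≡∅ pₙ₋₁ l pₙ₋₁∈B l∈C (Fin.toℕ-injective l≡pₙ₋₁))
        split-at-a : ¬ HullsMeet B⁺ C
        split-at-a with Fin.any? (λ l → C l Bool.≟ true ×-dec toℕ l ℕ.<? toℕ a)
                      | Fin.any? (λ l → C l Bool.≟ true ×-dec toℕ a ℕ.<? toℕ l)
        ... | yes (c₁ , c₁∈C , c₁<a) | yes (c₂ , c₂∈C , a<c₂) =
          λ _ → ¬meet (chords-meet c₁ a c₂ pₙ₋₁ a∈B pₙ₋₁∈B c₁∈C c₂∈C c₁<a a<c₂ (C<pₙ₋₁ c₂ c₂∈C))
        ... | no ∄c₁ | _ = ¬meet-between pₙ∉B pₙ∉C B⁺⊆B+pₙ a∈B a≤B pₙ₋₁∈B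
          (λ l l∈C → ℕ.≤∧≢⇒< (ℕ.≮⇒≥ λ l<a → ∄c₁ (l , l∈C , l<a)) (λ a≡l → B∩C≡∅ a l a∈B l∈C (Fin.toℕ-injective (sym a≡l))) ,
                     C<pₙ₋₁ l l∈C) ¬meet
        ... | yes _ | no ∄c₂ = ¬meet-before pₙ∉B pₙ∉C B⁺⊆B+pₙ a∈B a≤B
          (λ l l∈C → ℕ.≤∧≢⇒< (ℕ.≮⇒≥ λ a<l → ∄c₂ (l , l∈C , a<l)) (λ l≡a → B∩C≡∅ a l a∈B l∈C (Fin.toℕ-injective l≡a)))

module Parametrise (R : RealField) where

  open OrderedField R
  open Orientation R
  open Polygon R
  open Boundary R
  open FinLemmas
  open Geometry R
  open import Data.Nat as ℕ using (ℕ; zero; suc; s≤s; z≤n)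
  import Data.Nat.Properties as ℕ
  open import Data.Integer as ℤ using ()
  open import Data.Fin as Fin using (Fin; zero; suc; toℕ)
  import Data.Fin.Properties as Fin
  open import Data.Product using (Σ; _×_; _,_; proj₁; proj₂)
  open import Data.Sum using (_⊎_; inj₁; inj₂)
  open import Data.Empty using (⊥-elim)
  open import Relation.Nullary using (yes; no)
  open import Relation.Binary.PropositionalEquality

  module _ (K : ConvexPolygon) where
    open ConvexPolygon K

    vertex-on-edge : ∀ v E τ → 0# ≤ τ → τ < 1# → vert v ≡ lerp τ (vert E) (vert (cyc E)) → v ≡ E × τ ≡ 0#
    vertex-on-edge v E τ 0≤τ τ<1 v≡ with v Fin.≟ E | v Fin.≟ cyc E
    ... | yes refl | _ = refl , c*x≡0⇒x≡0 0<hE (trans (*-comm _ τ) τ*hE≡0)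
      where
      h : ℂ → ℝ
      h = orient (vert (cyc E)) (vert (cyc (cyc E)))
      0<hE : 0# < h (vert E)
      0<hE = convex (cyc E) E (cyc-≢ E) (cyc²-≢ E)
      hE≡ : h (vert E) ≡ (1# - τ) * h (vert E) + τ * 0#
      hE≡ = trans (cong h v≡) (trans (orient-lerp₃ _ _ τ (vert E) (vert (cyc E))) (cong (λ x → (1# - τ) * h (vert E) + τ * x) (orient-aba _ _)))
      τ*hE≡0 : τ * h (vert E) ≡ 0#
      τ*hE≡0 = trans (solve 2 (λ t x → t :* x := x :- ((con (ℤ.+ 1) :- t) :* x :+ t :* con (ℤ.+ 0))) refl τ (h (vert E)))
                     (trans (cong (λ x → h (vert E) - x) (sym hE≡)) (-‿inverseʳ _))
    ... | no _ | yes refl = ⊥-elim (<⇒≢ 0<h (sym h≡0))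
      where
      h : ℂ → ℝ
      h = orient (vert (cyc E)) (vert (cyc (cyc E)))
      h≡0 : h (vert (cyc E)) ≡ 0#
      h≡0 = orient-aba _ _
      0<h : 0# < h (vert (cyc E))
      0<h = subst (0# <_) (sym (trans (cong h v≡) (trans (orient-lerp₃ _ _ τ (vert E) (vert (cyc E)))
              (trans (cong (λ x → (1# - τ) * h (vert E) + τ * x) (orient-aba _ _)) (trans (cong ((1# - τ) * h (vert E) +_) (zeroʳ τ)) (+-identityʳ _))))))
              (*-pos (x<y⇒0<y-x τ<1) (convex (cyc E) E (cyc-≢ E) (cyc²-≢ E)))
    ... | no v≢E | no v≢E+1 = ⊥-elim (<⇒≢ (convex E v v≢E v≢E+1) (sym on-edge))
      where
      on-edge : orient (vert E) (vert (cyc E)) (vert v) ≡ 0#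
      on-edge = trans (cong (orient (vert E) (vert (cyc E))) v≡) (trans (orient-lerp₃ _ _ τ (vert E) (vert (cyc E)))
                  (trans (cong₂ (λ x y → (1# - τ) * x + τ * y) (orient-aba _ _) (orient-abb _ _))
                         (trans (cong₂ _+_ (zeroʳ _) (zeroʳ _)) (+-identityʳ 0#))))

  module FromConfig {m : ℕ} (p : Fin (suc (suc m)) → ℂ) (cfg : CCWBoundaryConfig p) where
    K : ConvexPolygon
    K = proj₁ cfg

    open ConvexPolygon K hiding (m)
    open ConvexPolygonProperties K
    open Indices m

    private
      e : Fin (suc (suc m)) → Fin N
      e = proj₁ (proj₂ cfg)
      t : Fin (suc (suc m)) → ℝ
      t = proj₁ (proj₂ (proj₂ cfg))
      on-edge : ∀ i → OnEdge K (e i) (t i) (p i)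
      on-edge = proj₁ (proj₂ (proj₂ (proj₂ cfg)))
      ordered′ : ∀ i j → toℕ i ℕ.< toℕ j → toℕ (e i) ℕ.< toℕ (e j) ⊎ (e i ≡ e j × t i < t j)
      ordered′ = proj₁ (proj₂ (proj₂ (proj₂ (proj₂ cfg))))
      pₙ-vertex : Σ (Fin N) λ v → vert v ≡ p pₙ
      pₙ-vertex = proj₂ (proj₂ (proj₂ (proj₂ (proj₂ (proj₂ cfg))))) pₙ (cong suc toℕ-pₙ)

      p≡lerp : ∀ i → p i ≡ lerp (t i) (vert (e i)) (vert (cyc (e i)))
      p≡lerp i = cong₂ _,_ (proj₁ (proj₂ (proj₂ (on-edge i)))) (proj₂ (proj₂ (proj₂ (on-edge i))))

      pₙ-at-vertex : proj₁ pₙ-vertex ≡ e pₙ × t pₙ ≡ 0#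
      pₙ-at-vertex = vertex-on-edge K (proj₁ pₙ-vertex) (e pₙ) (t pₙ) (proj₁ (on-edge pₙ)) (proj₁ (proj₂ (on-edge pₙ)))
                       (trans (proj₂ pₙ-vertex) (p≡lerp pₙ))

      before-pₙ : ∀ i → i ≢ pₙ → toℕ (e i) ℕ.< toℕ (e pₙ)
      before-pₙ i i≢pₙ with ordered′ i pₙ (<pₙ i i≢pₙ)
      ... | inj₁ eᵢ<eₙ       = eᵢ<eₙ
      ... | inj₂ (_ , tᵢ<tₙ) = ⊥-elim (≤⇒≯ (proj₁ (on-edge i)) (subst (t i <_) (proj₂ pₙ-at-vertex) tᵢ<tₙ))

    -- pₙ is the vertex V (suc k); it is the end of edge k rather than the start of edge k+1.
    k : ℕ
    k = ℕ.pred (toℕ (e pₙ))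

    private
      k+1≡ : suc k ≡ toℕ (e pₙ)
      k+1≡ = ℕ.suc-pred _ {{ℕ.>-nonZero (ℕ.≤-<-trans z≤n (before-pₙ zero (λ ())))}}

      k+1<N : suc k ℕ.< N
      k+1<N = subst (ℕ._< N) (sym k+1≡) (Fin.toℕ<n (e pₙ))

      eᵢ≤k : ∀ i → i ≢ pₙ → toℕ (e i) ℕ.≤ k
      eᵢ≤k i i≢pₙ = ℕ.≤-pred (subst (toℕ (e i) ℕ.<_) (sym k+1≡) (before-pₙ i i≢pₙ))

    edge : Fin (suc (suc m)) → ℕ
    edge i with i Fin.≟ pₙ
    ... | yes _ = k
    ... | no  _ = toℕ (e i)

    param : Fin (suc (suc m)) → ℝ
    param i with i Fin.≟ pₙ
    ... | yes _ = 1#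
    ... | no  _ = t i

    private
      V-k+1 : V (suc k) ≡ vert (e pₙ)
      V-k+1 = cong vert (trans (cong clamp k+1≡) (clamp-toℕ (e pₙ)))

      p≡point : ∀ i → p i ≡ point (edge i) (param i)
      p≡point i with i Fin.≟ pₙ
      ... | yes refl = trans (sym (proj₂ pₙ-vertex)) (trans (cong vert (proj₁ pₙ-at-vertex)) (trans (sym V-k+1) (sym (lerp-1 (V k) (V (suc k))))))
      ... | no  i≢pₙ = trans (p≡lerp i) (cong₂ (lerp (t i)) (cong vert (sym (clamp-toℕ (e i)))) (cong vert cyc-e≡))
        where
        eᵢ+1<N : suc (toℕ (e i)) ℕ.< N
        eᵢ+1<N = ℕ.≤-<-trans (s≤s (eᵢ≤k i i≢pₙ)) k+1<N
        cyc-e≡ : cyc (e i) ≡ clamp (suc (toℕ (e i)))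
        cyc-e≡ = trans (cong cyc (sym (clamp-toℕ (e i)))) (cyc-clamp (toℕ (e i)) eᵢ+1<N)

      edge≤k : ∀ i → edge i ℕ.≤ k
      edge≤k i with i Fin.≟ pₙ
      ... | yes _    = ℕ.≤-refl
      ... | no  i≢pₙ = eᵢ≤k i i≢pₙ

      param∈I : ∀ i → InUnit (param i)
      param∈I i with i Fin.≟ pₙ
      ... | yes _ = 0≤1 , ≤-refl
      ... | no  _ = proj₁ (on-edge i) , inj₁ (proj₁ (proj₂ (on-edge i)))

      param<1 : ∀ i → i ≢ pₙ → param i < 1#
      param<1 i i≢pₙ with i Fin.≟ pₙ
      ... | yes i≡pₙ = ⊥-elim (i≢pₙ i≡pₙ)
      ... | no  _    = proj₁ (proj₂ (on-edge i))

      edge-pₙ : edge pₙ ≡ k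
      edge-pₙ with pₙ Fin.≟ pₙ
      ... | yes _    = refl
      ... | no  ≢pₙ = ⊥-elim (≢pₙ refl)

      param-pₙ : param pₙ ≡ 1#
      param-pₙ with pₙ Fin.≟ pₙ
      ... | yes _    = refl
      ... | no  ≢pₙ = ⊥-elim (≢pₙ refl)

      ordered : ∀ i j → toℕ i ℕ.< toℕ j → LexLt (edge i) (param i) (edge j) (param j)
      ordered i j i<j with i Fin.≟ pₙ | j Fin.≟ pₙ
      ... | yes refl | _        = ⊥-elim (<⇒≢pₙ i<j refl)
      ... | no  i≢pₙ | yes refl with ℕ.m≤n⇒m<n∨m≡n (eᵢ≤k i i≢pₙ)
      ...   | inj₁ eᵢ<k = inj₁ eᵢ<k
      ...   | inj₂ eᵢ≡k = inj₂ (eᵢ≡k , proj₁ (proj₂ (on-edge i)))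
      ordered i j i<j | no _ | no _ with ordered′ i j i<j
      ... | inj₁ eᵢ<eⱼ        = inj₁ eᵢ<eⱼ
      ... | inj₂ (eᵢ≡eⱼ , tᵢ<tⱼ) = inj₂ (cong toℕ eᵢ≡eⱼ , tᵢ<tⱼ)

      cyc-clamp-k : cyc (clamp {suc (suc (ConvexPolygon.m K))} k) ≡ e pₙ
      cyc-clamp-k = trans (cyc-clamp k k+1<N) (trans (cong clamp k+1≡) (clamp-toℕ (e pₙ)))

      beyond-left : 0# < orient (V k) (V (suc k)) (vert (cyc (e pₙ)))
      beyond-left = subst (λ v → 0# < orient (V k) v (vert (cyc (e pₙ)))) (trans (cong vert cyc-clamp-k) (sym V-k+1))
        (convex (clamp k) (cyc (e pₙ)) (λ eq → cyc²-≢ (clamp k) (sym (trans (cong cyc cyc-clamp-k) eq)))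
                                       (λ eq → cyc-≢ (e pₙ) (sym (trans eq cyc-clamp-k))))

    parametrisation : Parametrisation K p
    parametrisation = record
      { k = k ; k+1<N = k+1<N ; edge = edge ; param = param ; p≡point = p≡point ; edge≤k = edge≤k ; param∈I = param∈I
      ; param<1 = param<1 ; edge-pₙ = edge-pₙ ; param-pₙ = param-pₙ ; ordered = ordered
      ; beyond = vert (cyc (e pₙ)) ; beyond-left = beyond-left }

module Partitions where

  open FinLemmas
  open import Data.Nat using (ℕ; suc)
  open import Data.Fin as Fin using (Fin; zero; suc; inject₁; fromℕ)
  import Data.Fin.Properties as Fin
  open import Data.Bool using (Bool; true; false)
  open import Data.Maybe using (Maybe; just; nothing; fromMaybe)
  open import Data.Empty using (⊥-elim)
  open import Relation.Binary.PropositionalEquality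

  module _ {k : ℕ} (σ : Partition k) where

    same-sym≡ : ∀ a c → same σ a c ≡ same σ c a
    same-sym≡ a c with same σ a c in ac | same σ c a in ca
    ... | true  | true  = refl
    ... | false | false = refl
    ... | true  | false = trans (sym (same-sym σ a c ac)) ca
    ... | false | true  = trans (sym ac) (same-sym σ c a ca)

    same-congʳ : ∀ {x y} z → same σ x y ≡ true → same σ z x ≡ same σ z y
    same-congʳ {x} {y} z x~y with same σ z x in zx | same σ z y in zy
    ... | true  | true  = refl
    ... | false | false = refl
    ... | true  | false = trans (sym (same-trans σ z x y zx x~y)) zy
    ... | false | true  = trans (sym zx) (same-trans σ z y x zy (same-sym σ x y x~y))

    same-congˡ : ∀ {x y} z → same σ x y ≡ true → same σ x z ≡ same σ y z
    same-congˡ {x} {y} z x~y = trans (same-sym≡ x z) (trans (same-congʳ z x~y) (same-sym≡ z y))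

  restrict : ∀ {k} → Partition (suc k) → Partition k
  restrict π = record
    { same       = λ i j → same π (inject₁ i) (inject₁ j)
    ; same-refl  = λ i → same-refl π (inject₁ i)
    ; same-sym   = λ i j → same-sym π (inject₁ i) (inject₁ j)
    ; same-trans = λ i j l → same-trans π (inject₁ i) (inject₁ j) (inject₁ l)
    }

  -- The new point is nothing; same⁺ true puts it in the block of the last old point
  -- fromℕ k, same⁺ false makes it a singleton.
  module _ {k : ℕ} (σ : Partition (suc k)) where

    same⁺ : Bool → Maybe (Fin (suc k)) → Maybe (Fin (suc k)) → Bool
    same⁺ true  x        y        = same σ (fromMaybe (fromℕ k) x) (fromMaybe (fromℕ k) y)
    same⁺ false (just a) (just c) = same σ a c
    same⁺ false nothing  nothing  = true
    same⁺ false (just _) nothing  = false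
    same⁺ false nothing  (just _) = false

    same⁺-refl : ∀ b x → same⁺ b x x ≡ true
    same⁺-refl true  x        = same-refl σ _
    same⁺-refl false (just a) = same-refl σ a
    same⁺-refl false nothing  = refl

    same⁺-sym : ∀ b x y → same⁺ b x y ≡ true → same⁺ b y x ≡ true
    same⁺-sym true  x        y        = same-sym σ _ _
    same⁺-sym false (just a) (just c) = same-sym σ a c
    same⁺-sym false nothing  nothing  _ = refl

    same⁺-trans : ∀ b x y z → same⁺ b x y ≡ true → same⁺ b y z ≡ true → same⁺ b x z ≡ true
    same⁺-trans true  x        y        z        = same-trans σ _ _ _
    same⁺-trans false (just a) (just c) (just d) = same-trans σ a c d
    same⁺-trans false nothing  nothing  nothing  _ _ = refl

    extend : Bool → Partition (suc (suc k))
    extend b = record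
      { same       = λ i j → same⁺ b (inject₁⁻¹ i) (inject₁⁻¹ j)
      ; same-refl  = λ i → same⁺-refl b (inject₁⁻¹ i)
      ; same-sym   = λ i j → same⁺-sym b (inject₁⁻¹ i) (inject₁⁻¹ j)
      ; same-trans = λ i j l → same⁺-trans b (inject₁⁻¹ i) (inject₁⁻¹ j) (inject₁⁻¹ l)
      }

    restrict-extend : ∀ b i j → same (restrict (extend b)) i j ≡ same σ i j
    restrict-extend true  i j rewrite inject₁⁻¹-inject₁ i | inject₁⁻¹-inject₁ j = refl
    restrict-extend false i j rewrite inject₁⁻¹-inject₁ i | inject₁⁻¹-inject₁ j = refl

    extend-joins : ∀ b → same (extend b) (inject₁ (fromℕ k)) (fromℕ (suc k)) ≡ b
    extend-joins b rewrite inject₁⁻¹-inject₁ (fromℕ k) | inject₁⁻¹-fromℕ (suc k) with b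
    ... | true  = same-refl σ (fromℕ k)
    ... | false = refl

    extend-singleton : ∀ j → same (extend false) (fromℕ (suc k)) j ≡ true → j ≡ fromℕ (suc k)
    extend-singleton j j~new rewrite inject₁⁻¹-fromℕ (suc k) with inject₁⁻¹ j in eqⱼ
    ... | nothing = inject₁⁻¹≡nothing j eqⱼ

  module _ {k : ℕ} {σ σ′ : Partition (suc k)} where

    extend-cong : (∀ a c → same σ a c ≡ same σ′ a c) → ∀ b i j → same (extend σ b) i j ≡ same (extend σ′ b) i j
    extend-cong σ≡σ′ b i j = go b (inject₁⁻¹ i) (inject₁⁻¹ j)
      where
      go : ∀ b x y → same⁺ σ b x y ≡ same⁺ σ′ b x y
      go true  x        y        = σ≡σ′ _ _
      go false (just a) (just c) = σ≡σ′ a c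
      go false nothing  nothing  = refl
      go false (just _) nothing  = refl
      go false nothing  (just _) = refl

    extend-mono : (∀ a c → same σ a c ≡ true → same σ′ a c ≡ true) → ∀ {b b′} → (b ≡ true → b′ ≡ true) →
                  ∀ i j → same (extend σ b) i j ≡ true → same (extend σ′ b′) i j ≡ true
    extend-mono σ≤σ′ {b} {b′} b⇒b′ i j = go b b′ b⇒b′ (inject₁⁻¹ i) (inject₁⁻¹ j)
      where
      go : ∀ b b′ → (b ≡ true → b′ ≡ true) → ∀ x y → same⁺ σ b x y ≡ true → same⁺ σ′ b′ x y ≡ true
      go true  true  _ x        y        = σ≤σ′ _ _
      go true  false b⇒b′ _ _ _ with () ← b⇒b′ refl
      go false true  _ (just a) (just c) = σ≤σ′ a c
      go false true  _ nothing  nothing  _ = same-refl σ′ (fromℕ k)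
      go false false _ (just a) (just c) = σ≤σ′ a c
      go false false _ nothing  nothing  _ = refl

  module _ {k : ℕ} (π : Partition (suc (suc k))) where
    private
      new old : Fin (suc (suc k))
      new = fromℕ (suc k)
      old = inject₁ (fromℕ k)

    extend-restrict-together : same π old new ≡ true → ∀ i j → same π i j ≡ same (extend (restrict π) true) i j
    extend-restrict-together old~new i j with inject₁⁻¹ i in eqᵢ | inject₁⁻¹ j in eqⱼ
    ... | just a  | just c  rewrite inject₁⁻¹≡just i a eqᵢ | inject₁⁻¹≡just j c eqⱼ = refl
    ... | just a  | nothing rewrite inject₁⁻¹≡just i a eqᵢ | inject₁⁻¹≡nothing j eqⱼ = sym (same-congʳ π (inject₁ a) old~new)
    ... | nothing | just c  rewrite inject₁⁻¹≡nothing i eqᵢ | inject₁⁻¹≡just j c eqⱼ = sym (same-congˡ π (inject₁ c) old~new)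
    ... | nothing | nothing rewrite inject₁⁻¹≡nothing i eqᵢ | inject₁⁻¹≡nothing j eqⱼ =
      trans (same-refl π new) (sym (same-refl π old))

    new-apart : (∀ j → same π new j ≡ true → j ≡ new) → ∀ a → same π new (inject₁ a) ≡ false
    new-apart new-alone a with same π new (inject₁ a) in new~a
    ... | true  = ⊥-elim (Fin.fromℕ≢inject₁ (sym (new-alone (inject₁ a) new~a)))
    ... | false = refl

    extend-restrict-singleton : (∀ j → same π new j ≡ true → j ≡ new) → ∀ i j → same π i j ≡ same (extend (restrict π) false) i j
    extend-restrict-singleton new-alone i j with inject₁⁻¹ i in eqᵢ | inject₁⁻¹ j in eqⱼ
    ... | just a  | just c  rewrite inject₁⁻¹≡just i a eqᵢ | inject₁⁻¹≡just j c eqⱼ = refl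
    ... | just a  | nothing rewrite inject₁⁻¹≡just i a eqᵢ | inject₁⁻¹≡nothing j eqⱼ =
      trans (same-sym≡ π (inject₁ a) new) (new-apart new-alone a)
    ... | nothing | just c  rewrite inject₁⁻¹≡nothing i eqᵢ | inject₁⁻¹≡just j c eqⱼ = new-apart new-alone c
    ... | nothing | nothing rewrite inject₁⁻¹≡nothing i eqᵢ | inject₁⁻¹≡nothing j eqⱼ = same-refl π new

  two-point : Bool → Partition 2
  two-point b = record { same = same₂ ; same-refl = refl₂ ; same-sym = sym₂ ; same-trans = trans₂ }
    where
    same₂ : Fin 2 → Fin 2 → Bool
    same₂ zero       zero       = true
    same₂ (suc zero) (suc zero) = true
    same₂ zero       (suc zero) = b
    same₂ (suc zero) zero       = b
    refl₂ : ∀ i → same₂ i i ≡ true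
    refl₂ zero       = refl
    refl₂ (suc zero) = refl
    sym₂ : ∀ i j → same₂ i j ≡ true → same₂ j i ≡ true
    sym₂ zero       zero       i~j = i~j
    sym₂ (suc zero) (suc zero) i~j = i~j
    sym₂ zero       (suc zero) i~j = i~j
    sym₂ (suc zero) zero       i~j = i~j
    trans₂ : ∀ i j l → same₂ i j ≡ true → same₂ j l ≡ true → same₂ i l ≡ true
    trans₂ zero       zero       l          _   j~l = j~l
    trans₂ (suc zero) (suc zero) l          _   j~l = j~l
    trans₂ zero       (suc zero) zero       _   _   = refl
    trans₂ zero       (suc zero) (suc zero) i~j _   = i~j
    trans₂ (suc zero) zero       (suc zero) _   _   = refl
    trans₂ (suc zero) zero       zero       i~j _   = i~j

  two-point-same : ∀ (ρ : Partition 2) i j → same (two-point (same ρ zero (suc zero))) i j ≡ same ρ i j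
  two-point-same ρ zero       zero       = sym (same-refl ρ zero)
  two-point-same ρ (suc zero) (suc zero) = sym (same-refl ρ (suc zero))
  two-point-same ρ zero       (suc zero) = refl
  two-point-same ρ (suc zero) zero       = same-sym≡ ρ zero (suc zero)

  two-point-mono : ∀ {b b′} → (b ≡ true → b′ ≡ true) → ∀ i j → same (two-point b) i j ≡ true → same (two-point b′) i j ≡ true
  two-point-mono b⇒b′ zero       zero       _   = refl
  two-point-mono b⇒b′ (suc zero) (suc zero) _   = refl
  two-point-mono b⇒b′ zero       (suc zero) i~j = b⇒b′ i~j
  two-point-mono b⇒b′ (suc zero) zero       i~j = b⇒b′ i~j

module Noncrossing (R : RealField) where

  open ConvexHull R
  open Boundary R
  open Partitions
  open FinLemmas
  open Geometry R
  open import Data.Nat using (ℕ; suc)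
  open import Data.Fin as Fin using (Fin; zero; suc; inject₁; fromℕ)
  open import Data.Bool using (Bool; true; false)
  open import Data.Empty using (⊥-elim)
  open import Data.Maybe using (Maybe; just; nothing; fromMaybe)
  open import Data.Product using (Σ; _×_; _,_)
  open import Relation.Nullary using (¬_; does)
  open import Relation.Nullary.Decidable using (dec-true; dec-false)
  open import Relation.Binary.PropositionalEquality
  open import Function using (_∘_)

  restrict-NC : ∀ {k} (q : Fin (suc k) → ℂ) {π} → NonCrossing q π → NonCrossing (q ∘ inject₁) (restrict π)
  restrict-NC q nc i j i≁j (z , z∈i , z∈j) =
    nc (inject₁ i) (inject₁ j) i≁j (z , hull-inject₁ q (λ _ → refl) z∈i , hull-inject₁ q (λ _ → refl) z∈j)

  two-point-NC : ∀ {x y : ℂ} → x ≢ y → ∀ b → NonCrossing (pair x y) (two-point b)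
  two-point-NC         x≢y b zero       zero       ()
  two-point-NC         x≢y b (suc zero) (suc zero) ()
  two-point-NC {x} {y} x≢y b zero       (suc zero) refl (z , z∈x , z∈y) =
    x≢y (trans (sym (hull-singleton (pair x y) zero only-x z∈x)) (hull-singleton (pair x y) (suc zero) only-y z∈y))
    where
    only-x : ∀ l → same (two-point false) zero l ≡ true → l ≡ zero
    only-x zero       _  = refl
    only-x (suc zero) ()
    only-y : ∀ l → same (two-point false) (suc zero) l ≡ true → l ≡ suc zero
    only-y zero       ()
    only-y (suc zero) _  = refl
  two-point-NC         x≢y b (suc zero) zero       refl (z , z∈y , z∈x) = two-point-NC x≢y false zero (suc zero) refl (z , z∈x , z∈y)

  module _ (K : ConvexPolygon) {m : ℕ} (p : Fin (suc (suc m)) → ℂ) (par : Parametrisation K p) where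
    open Indices m

    private
      true≢false : true ≢ false
      true≢false ()

      block⁺ : Partition (suc m) → Bool → Maybe (Fin (suc m)) → Fin (suc (suc m)) → Bool
      block⁺ σ b x l = same⁺ σ b x (inject₁⁻¹ l)

      block⁺-inject₁ : ∀ σ b a l → block⁺ σ b (just a) (inject₁ l) ≡ same σ a l
      block⁺-inject₁ σ true  a l rewrite inject₁⁻¹-inject₁ l = refl
      block⁺-inject₁ σ false a l rewrite inject₁⁻¹-inject₁ l = refl

      block⁺-pₙ : ∀ σ b x → block⁺ σ b x pₙ ≡ same⁺ σ b x nothing
      block⁺-pₙ σ b x rewrite inject₁⁻¹-fromℕ (suc m) = refl

      restrict-meet : ∀ {σ b b′ a c} → same⁺ σ b (just a) nothing ≡ false → same⁺ σ b′ (just c) nothing ≡ false →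
                      HullsMeet K p par (block⁺ σ b (just a)) (block⁺ σ b′ (just c)) →
                      Σ ℂ λ z → InHull (p ∘ inject₁) (same σ a) z × InHull (p ∘ inject₁) (same σ c) z
      restrict-meet {σ} {b} {b′} {a} {c} a≁pₙ c≁pₙ (z , z∈a , z∈c) =
        z , hull-restrict p (block⁺-inject₁ σ b a) (trans (block⁺-pₙ σ b (just a)) a≁pₙ) z∈a
          , hull-restrict p (block⁺-inject₁ σ b′ c) (trans (block⁺-pₙ σ b′ (just c)) c≁pₙ) z∈c

      top : Fin (suc m)
      top = fromℕ m

      swap-meet : ∀ {B C} → HullsMeet K p par B C → HullsMeet K p par C B
      swap-meet (z , z∈B , z∈C) = z , z∈C , z∈B

      -- The block of x in extend σ true contains pₙ and pₙ₋₁; it is the block of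
      -- fromMaybe top x in extend σ false together with pₙ.
      joined-block-¬meet : ∀ σ → NonCrossing (p ∘ inject₁) σ → ∀ x c → same σ (fromMaybe top x) top ≡ true →
                           same σ (fromMaybe top x) c ≡ false → same σ c top ≡ false →
                           ¬ HullsMeet K p par (block⁺ σ true x) (block⁺ σ true (just c))
      joined-block-¬meet σ nc x c x~top x≁c c≁top =
        join-pₙ-keeps-¬meet K p par (block⁺-pₙ σ false (just a)) (trans (block⁺-pₙ σ true (just c)) c≁top)
          (trans (block⁺-inject₁ σ false a top) x~top) B⁺⊆B+pₙ (λ meet → nc a c x≁c (restrict-meet {σ} {false} {true} {a} {c} refl c≁top meet))
        where
        a : Fin (suc m)
        a = fromMaybe top x
        B⁺⊆B+pₙ : ∀ l → block⁺ σ true x l ≡ true → l ≢ pₙ → block⁺ σ false (just a) l ≡ true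
        B⁺⊆B+pₙ l l∈B⁺ l≢pₙ with inject₁⁻¹ l in eqₗ
        ... | just _  = l∈B⁺
        ... | nothing = ⊥-elim (l≢pₙ (inject₁⁻¹≡nothing l eqₗ))

      singleton-¬meet : ∀ σ a → ¬ HullsMeet K p par (block⁺ σ false (just a)) (block⁺ σ false nothing)
      singleton-¬meet σ a (z , z∈a , z∈pₙ) =
        pₙ∉hull K p par (block⁺ σ false (just a)) (block⁺-pₙ σ false (just a))
          (subst (InHull p (block⁺ σ false (just a))) (hull-singleton p pₙ only-pₙ z∈pₙ) z∈a)
        where
        only-pₙ : ∀ l → block⁺ σ false nothing l ≡ true → l ≡ pₙ
        only-pₙ l l∈pₙ with inject₁⁻¹ l in eqₗ
        ... | nothing = inject₁⁻¹≡nothing l eqₗ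

    extend-NC : ∀ σ → NonCrossing (p ∘ inject₁) σ → ∀ b → NonCrossing p (extend σ b)
    extend-NC σ nc b i j = ¬meet-blocks b (inject₁⁻¹ i) (inject₁⁻¹ j)
      where
      ¬meet-blocks : ∀ b x y → same⁺ σ b x y ≡ false → ¬ HullsMeet K p par (block⁺ σ b x) (block⁺ σ b y)
      ¬meet-blocks false (just a) (just c) a≁c meet = nc a c a≁c (restrict-meet {σ} {false} {false} {a} {c} refl refl meet)
      ¬meet-blocks false (just a) nothing  _   meet = singleton-¬meet σ a meet
      ¬meet-blocks false nothing  (just c) _   meet = singleton-¬meet σ c (swap-meet meet)
      ¬meet-blocks true  (just a) (just c) a≁c with same σ a top in a~top | same σ c top in c~top
      ... | true  | true  = λ _ → true≢false (trans (sym (same-trans σ a top c a~top (same-sym σ c top c~top))) a≁c)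
      ... | false | false = λ meet → nc a c a≁c (restrict-meet {σ} {true} {true} {a} {c} a~top c~top meet)
      ... | true  | false = joined-block-¬meet σ nc (just a) c a~top a≁c c~top
      ... | false | true  = λ meet → joined-block-¬meet σ nc (just c) a c~top (trans (same-sym≡ σ c a) a≁c) a~top (swap-meet meet)
      ¬meet-blocks true  (just a) nothing  a≁top meet =
        joined-block-¬meet σ nc nothing a (same-refl σ top) (trans (same-sym≡ σ top a) a≁top) a≁top (swap-meet meet)
      ¬meet-blocks true  nothing  (just c) top≁c =
        joined-block-¬meet σ nc nothing c (same-refl σ top) top≁c (trans (same-sym≡ σ c top) top≁c)
      ¬meet-blocks true  nothing  nothing  top≁top _ = true≢false (trans (sym (same-refl σ top)) top≁top)

    p-pₙ₋₁≢p-pₙ : p pₙ₋₁ ≢ p pₙ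
    p-pₙ₋₁≢p-pₙ eq = pₙ∉hull K p par A (dec-false (pₙ Fin.≟ pₙ₋₁) (λ pₙ≡pₙ₋₁ → pₙ₋₁≢pₙ (sym pₙ≡pₙ₋₁)))
                       (subst (InHull p A) eq (hull-point p pₙ₋₁ (dec-true (pₙ₋₁ Fin.≟ pₙ₋₁) refl)))
      where
      A : Fin (suc (suc m)) → Bool
      A l = does (l Fin.≟ pₙ₋₁)

open Partitions

module Isomorphisms (R : RealField) where
  open Geometry R
  open Boundary R
  open Noncrossing R

  module _ (K : ConvexPolygon) {m : ℕ} (p : Fin (suc (suc m)) → ℂ) (par : Parametrisation K p) where
    open Indices m

    Together Singleton : Carrier (NC p) → Set
    Together π  = same (proj₁ π) pₙ₋₁ pₙ ≡ true
    Singleton π = ∀ j → same (proj₁ π) pₙ j ≡ true → j ≡ pₙ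

    private
      restrictₙ : Carrier (NC p) → Carrier (NC (p ∘ inject₁))
      restrictₙ (π , nc) = restrict π , restrict-NC p {π} nc

      extendₙ : Carrier (NC (p ∘ inject₁)) → Bool → Carrier (NC p)
      extendₙ (σ , nc) b = extend σ b , extend-NC K p par σ nc b

      two-pointₙ : Bool → Carrier (NC (pair (p pₙ₋₁) (p pₙ)))
      two-pointₙ b = two-point b , two-point-NC (p-pₙ₋₁≢p-pₙ K p par) b

      extend-restrict : ∀ π → Together π ⊎ Singleton π → ∀ i j →
                        same (proj₁ π) i j ≡ same (extend (restrict (proj₁ π)) (same (proj₁ π) pₙ₋₁ pₙ)) i j
      extend-restrict (π , _) (inj₁ together) i j rewrite together = extend-restrict-together π together i j
      extend-restrict (π , _) (inj₂ alone)  i j rewrite trans (same-sym≡ π pₙ₋₁ pₙ) (new-apart π alone (fromℕ m)) =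
        extend-restrict-singleton π alone i j

    together-iso : Sub (NC p) Together ≅ₒ NC (p ∘ inject₁)
    together-iso = restrictₙ ∘ proj₁ , record
      { isOrderMonomorphism = record
        { isOrderHomomorphism = record
          { cong = λ π≈μ i j → π≈μ (inject₁ i) (inject₁ j)
          ; mono = λ π≤μ i j → π≤μ (inject₁ i) (inject₁ j) }
        ; injective = λ { {(π , _) , π-together} {(μ , _) , μ-together} π≈μ i j →
            trans (extend-restrict-together π π-together i j)
                  (trans (extend-cong {σ = restrict π} {restrict μ} π≈μ true i j) (sym (extend-restrict-together μ μ-together i j))) }
        ; cancel = λ { {(π , _) , π-together} {(μ , _) , μ-together} π≤μ i j π-ij →
            trans (extend-restrict-together μ μ-together i j)
                  (extend-mono {σ = restrict π} {restrict μ} π≤μ {true} {true} id i j (trans (sym (extend-restrict-together π π-together i j)) π-ij)) } }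
      ; surjective = λ σ → (extendₙ σ true , extend-joins (proj₁ σ) true) ,
                           λ σ≈ i j → trans (σ≈ (inject₁ i) (inject₁ j)) (restrict-extend (proj₁ σ) true i j)
      }

    private
      together-or-singleton : ∀ σ b → Together (extendₙ σ b) ⊎ Singleton (extendₙ σ b)
      together-or-singleton (σ , _) true  = inj₁ (extend-joins σ true)
      together-or-singleton (σ , _) false = inj₂ (extend-singleton σ)

    together-or-singleton-iso : Sub (NC p) (λ π → Together π ⊎ Singleton π) ≅ₒ (NC (p ∘ inject₁) ×ₒ NC (pair (p pₙ₋₁) (p pₙ)))
    together-or-singleton-iso = (λ (π , _) → restrictₙ π , two-pointₙ (same (proj₁ π) pₙ₋₁ pₙ)) , record
      { isOrderMonomorphism = record
        { isOrderHomomorphism = record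
          { cong = λ π≈μ → (λ i j → π≈μ (inject₁ i) (inject₁ j)) , λ i j → cong (λ b → same (two-point b) i j) (π≈μ pₙ₋₁ pₙ)
          ; mono = λ π≤μ → (λ i j → π≤μ (inject₁ i) (inject₁ j)) , two-point-mono (π≤μ pₙ₋₁ pₙ) }
        ; injective = λ { {π , π-cases} {μ , μ-cases} (π≈μ , bπ≡bμ) i j →
            trans (extend-restrict π π-cases i j)
                  (trans (extend-cong {σ = restrict (proj₁ π)} {restrict (proj₁ μ)} π≈μ (same (proj₁ π) pₙ₋₁ pₙ) i j)
                         (trans (cong (λ b → same (extend (restrict (proj₁ μ)) b) i j) (bπ≡bμ zero (suc zero)))
                                (sym (extend-restrict μ μ-cases i j)))) }
        ; cancel = λ { {π , π-cases} {μ , μ-cases} (π≤μ , bπ⇒bμ) i j π-ij →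
            trans (extend-restrict μ μ-cases i j)
                  (extend-mono {σ = restrict (proj₁ π)} {restrict (proj₁ μ)} π≤μ (bπ⇒bμ zero (suc zero)) i j
                     (trans (sym (extend-restrict π π-cases i j)) π-ij)) } }
      ; surjective = λ (σ , ρ) → let b = same (proj₁ ρ) zero (suc zero) in
          (extendₙ σ b , together-or-singleton σ b) ,
          λ σb≈ → (λ i j → trans (σb≈ (inject₁ i) (inject₁ j)) (restrict-extend (proj₁ σ) b i j)) ,
                  (λ i j → trans (cong (λ b′ → same (two-point b′) i j) (trans (σb≈ pₙ₋₁ pₙ) (extend-joins (proj₁ σ) b)))
                                 (two-point-same (proj₁ ρ) i j))
      }

open Parametrise

lemma2p7 : (R : RealField) → let open Geometry R in
    (m : ℕ) (p : Fin (suc (suc m)) → ℂ) → CCWBoundaryConfig p →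
    let pₙ₋₁ = inject₁ (fromℕ m)
        pₙ = fromℕ (suc m)
        P∖pₙ = p ∘ inject₁
        Together = λ (π : Carrier (NC p)) → same (proj₁ π) pₙ₋₁ pₙ ≡ true
        Singleton = λ (π : Carrier (NC p)) → ∀ j → same (proj₁ π) pₙ j ≡ true → j ≡ pₙ
    in (Sub (NC p) Together ≅ₒ NC P∖pₙ)
     × (Sub (NC p) (λ π → Together π ⊎ Singleton π) ≅ₒ (NC P∖pₙ ×ₒ NC (pair (p pₙ₋₁) (p pₙ))))
lemma2p7 R m p cfg = together-iso K p parametrisation , together-or-singleton-iso K p parametrisation
  where
  open Isomorphisms R
  open FromConfig R p cfg using (K; parametrisation)
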